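{- For $\alpha\in\mathbf l[n]$ define $$\chi_\alpha(t)=\sum_{a\models n}c_a(\alpha)\binom{t}{\ell(a)},$$ where the sum is over integer compositions $a=(a_1,\dots,a_\ell)$ of $n$, $\ell(a)=\ell$, and $c_a(\alpha)$ is the number of set compositions $A=(A_1,\dots,A_\ell)$ of $[n]$ with $|A_i|=a_i$ and $\alpha|_{A_i}$ increasing for all $i$. Then for every positive integer $t$, $\chi_\alpha(t)$ counts the number of ways to color the entries of $\alpha$ with at most $t$ distinct colors (maps $f:[n]\to[t]$) so that the restriction of $\alpha$ to each color class is increasing. Moreover $$\chi_\alpha(-1)=(-1)^n d_{\alpha,\epsilon},$$ where $d_{\alpha,\epsilon}$ is the number of $\beta=\beta_1\cdots\beta_n\in\mathbf l[n]$ such that for every $1\le i<n$, $\beta_i>\beta_{i+1}$ or $\alpha^{ -1}(\beta_i)>\alpha^{ -1}(\beta_{i+1})$.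
   Context: $\mathbf l[n]$ is the set of words $\alpha=\alpha_1\cdots\alpha_n$ that are linear orders (permutations) of $[n]=\{1,\dots,n\}$, and $\epsilon=12\cdots n$. $\alpha|_S$ is the subword of $\alpha$ consisting of the letters in $S$; it is increasing if its letters appear in increasing numerical order. $\alpha^{ -1}(j)$ is the position of $j$ in $\alpha$. A set composition of $[n]$ is a sequence of nonempty pairwise disjoint subsets with union $[n]$. -}

module Defs where

open import Data.Nat as ℕ using (ℕ; zero; suc; _!)
open import Data.Nat.Properties using (_!≢0)
open import Data.Integer as ℤ using (ℤ; +_)
open import Data.Integer.DivMod using (_/_)
open import Data.Fin as Fin using (Fin; toℕ)
open import Data.Fin.Properties using (all?; any?; _≟_; _<?_)
open import Data.Fin.Permutation using (Permutation′; _⟨$⟩ʳ_; _⟨$⟩ˡ_)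
open import Data.Fin.Subset using (Subset; _∈_; ∣_∣)
open import Data.Fin.Subset.Properties using (_∈?_)
open import Data.Vec as Vec using (Vec; []; _∷_; lookup)
open import Data.Bool using (Bool; true; false)
open import Data.List as List using (List; []; _∷_; filter; length; concatMap; allFin; upTo)
open import Data.Product using (_×_; ∃)
open import Data.Sum using (_⊎_)
open import Relation.Binary.PropositionalEquality using (_≡_; _≢_)
open import Relation.Nullary using (Dec; ¬_; ¬?)
open import Relation.Nullary.Decidable using (_×-dec_; _⊎-dec_; _→-dec_)
open import Relation.Unary using (Decidable)
import Data.Nat.Properties as ℕP

allVecs : ∀ {a} {A : Set a} → List A → (k : ℕ) → List (Vec A k)
allVecs xs zero    = [] ∷ []
allVecs xs (suc k) = concatMap (λ x → List.map (x ∷_) (allVecs xs k)) xs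

count : ∀ {a p} {A : Set a} {P : A → Set p} → Decidable P → List A → ℕ
count P? xs = length (filter P? xs)

allSubsets : (n : ℕ) → List (Subset n)
allSubsets n = allVecs (true ∷ false ∷ []) n

sumℤ : List ℤ → ℤ
sumℤ = List.foldr ℤ._+_ (+ 0)

fallingℤ : ℤ → ℕ → ℤ
fallingℤ t zero    = + 1
fallingℤ t (suc k) = fallingℤ t k ℤ.* (t ℤ.- + k)

binomℤ : ℤ → ℕ → ℤ
binomℤ t k = (fallingℤ t k / (+ (k !))) {{k !≢0}}

-- Permutations (linear orders) of [n] = Fin n.
-- α ⟨$⟩ʳ i is the letter α_i at position i; α ⟨$⟩ˡ j = α^{-1}(j).

IncreasingOn : ∀ {n} → Permutation′ n → Subset n → Set
IncreasingOn {n} α S =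
  ∀ (i j : Fin n) → i Fin.< j → (α ⟨$⟩ʳ i) ∈ S → (α ⟨$⟩ʳ j) ∈ S →
  (α ⟨$⟩ʳ i) Fin.< (α ⟨$⟩ʳ j)

IncreasingOn? : ∀ {n} (α : Permutation′ n) → Decidable (IncreasingOn α)
IncreasingOn? α S =
  all? λ i → all? λ j → (i <? j) →-dec ((_ ∈? S) →-dec ((_ ∈? S) →-dec (_ <? _)))

IsComposition : (n : ℕ) {ℓ : ℕ} → Vec ℕ ℓ → Set
IsComposition n {ℓ} a = (∀ (k : Fin ℓ) → 1 ℕ.≤ lookup a k) × (Vec.sum a ≡ n)

IsComposition? : (n : ℕ) {ℓ : ℕ} → Decidable (IsComposition n {ℓ})
IsComposition? n a = all? (λ k → 1 ℕ.≤? lookup a k) ×-dec (Vec.sum a ℕP.≟ n)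

compositions : (n ℓ : ℕ) → List (Vec ℕ ℓ)
compositions n ℓ =
  filter (IsComposition? n) (List.map (Vec.map toℕ) (allVecs (allFin (suc n)) ℓ))

PairwiseDisjoint : ∀ {n ℓ} → Vec (Subset n) ℓ → Set
PairwiseDisjoint {n} {ℓ} As =
  ∀ (k k' : Fin ℓ) → k ≢ k' → ∀ (x : Fin n) → x ∈ lookup As k → ¬ (x ∈ lookup As k')

Covers : ∀ {n ℓ} → Vec (Subset n) ℓ → Set
Covers {n} {ℓ} As = ∀ (x : Fin n) → ∃ λ (k : Fin ℓ) → x ∈ lookup As k

IncrSetCompOfType : ∀ {n ℓ} → Permutation′ n → Vec ℕ ℓ → Vec (Subset n) ℓ → Set
IncrSetCompOfType {n} {ℓ} α a As =
  PairwiseDisjoint As × Covers As ×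
  (∀ (k : Fin ℓ) → ∣ lookup As k ∣ ≡ lookup a k) ×
  (∀ (k : Fin ℓ) → IncreasingOn α (lookup As k))

IncrSetCompOfType? : ∀ {n ℓ} (α : Permutation′ n) (a : Vec ℕ ℓ) →
                     Decidable (IncrSetCompOfType α a)
IncrSetCompOfType? α a As =
  (all? λ k → all? λ k' → ¬? (k ≟ k') →-dec (all? λ x → (x ∈? _) →-dec ¬? (x ∈? _)))
  ×-dec (all? λ x → any? λ k → x ∈? lookup As k)
  ×-dec (all? λ k → ∣ lookup As k ∣ ℕP.≟ lookup a k)
  ×-dec (all? λ k → IncreasingOn? α (lookup As k))

c : ∀ {n ℓ} → Vec ℕ ℓ → Permutation′ n → ℕ
c {n} {ℓ} a α = count (IncrSetCompOfType? α a) (allVecs (allSubsets n) ℓ)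

χ : ∀ {n} → Permutation′ n → ℤ → ℤ
χ {n} α t =
  sumℤ (List.map (λ ℓ → sumℤ (List.map (λ a → + (c a α) ℤ.* binomℤ t ℓ)
                                        (compositions n ℓ)))
                 (upTo (suc n)))

GoodColoring : ∀ {n t} → Permutation′ n → Vec (Fin t) n → Set
GoodColoring {n} α f =
  ∀ (i j : Fin n) → i Fin.< j → lookup f (α ⟨$⟩ʳ i) ≡ lookup f (α ⟨$⟩ʳ j) →
  (α ⟨$⟩ʳ i) Fin.< (α ⟨$⟩ʳ j)

GoodColoring? : ∀ {n t} (α : Permutation′ n) → Decidable (GoodColoring {n} {t} α)
GoodColoring? α f =
  all? λ i → all? λ j → (i <? j) →-dec ((_ ≟ _) →-dec (_ <? _))

numColorings : ∀ {n} → Permutation′ n → ℕ → ℕ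
numColorings {n} α t = count (GoodColoring? α) (allVecs (allFin t) n)

IsLinearOrder : ∀ {n} → Vec (Fin n) n → Set
IsLinearOrder {n} β = ∀ (i j : Fin n) → lookup β i ≡ lookup β j → i ≡ j

DescCond : ∀ {n} → Permutation′ n → Vec (Fin n) n → Set
DescCond {n} α β =
  ∀ (i j : Fin n) → toℕ j ≡ suc (toℕ i) →
  (lookup β j Fin.< lookup β i) ⊎ ((α ⟨$⟩ˡ lookup β j) Fin.< (α ⟨$⟩ˡ lookup β i))

DCond? : ∀ {n} (α : Permutation′ n) → Decidable (λ β → IsLinearOrder β × DescCond α β)
DCond? α β =
  (all? λ i → all? λ j → (_ ≟ _) →-dec (i ≟ j))
  ×-dec (all? λ i → all? λ j → (toℕ j ℕP.≟ suc (toℕ i)) →-dec ((_ <? _) ⊎-dec (_ <? _)))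

d : ∀ {n} → Permutation′ n → ℕ
d {n} α = count (DCond? α) (allVecs (allFin n) n)

-- Call x ≺ y when x < y and x precedes y in α; the blocks A with α|_A increasing are exactly
-- the ≺-chains, so c_a(α) counts ordered partitions of [n] into nonempty chains of sizes a,
-- and χ_α(t) = Σ_ℓ binom(t,ℓ) p_ℓ with p_ℓ the number of ordered partitions into ℓ nonempty
-- chains. Doing this for every set S of letters, Pascal's rule (valid for integer t) gives
--   χ_S(t+1) = χ_S(t) + Σ_B χ_{S∖B}(t)        (B ranging over the nonempty chains in S).
-- For t ∈ ℕ this is the recursion for ordered partitions of S into t possibly empty chains,
-- i.e. for the colour classes of the admissible colourings. At t = −1, with σ_S = χ_S(−1),
-- it reads σ_S = [S = ∅] − Σ_B σ_{S∖B}; grouping the chains B by their ≺-least element x and peeling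
-- x off, the part belonging to x equals (−1)^{|S|−1} times the number of words that list S,
-- start with x, and never step up in ≺. Hence σ_S = (−1)^{|S|} times the number of such
-- words, which for S = [n] is d_{α,ε}.

module Submission where

open import Defs
open import Level using (Level)
open import Function using (_∘_; id)
open import Data.Bool as Bool using (Bool; true; false; if_then_else_)
open import Data.Empty using (⊥-elim)
open import Data.Unit using (tt) renaming (⊤ to Unit)
open import Data.Product as Product using (_×_; _,_; proj₁; proj₂; ∃)
open import Data.Sum using (_⊎_; inj₁; inj₂; fromInj₂)
open import Data.Maybe using (Maybe; just; nothing)
open import Data.Nat as ℕ using (ℕ; zero; suc; _≤_; _<_; z≤n; s≤s; _!)
import Data.Nat.Properties as ℕP
import Data.Nat.DivMod as ℕD
open import Data.Integer as ℤ using (ℤ; +_; -[1+_]; 0ℤ; 1ℤ; _+_; _*_; -_; _-_; _^_; _/ℕ_)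
import Data.Integer.Properties as ℤP
open import Data.Integer.DivMod using (_/_)
open import Data.Integer.Tactic.RingSolver using (solve-∀)
open import Data.Fin as Fin using (Fin; zero; suc; toℕ)
import Data.Fin.Properties as FinP
open import Data.Fin.Permutation using (Permutation′; _⟨$⟩ʳ_; _⟨$⟩ˡ_; inverseˡ; inverseʳ)
open import Data.Fin.Subset
  using (Subset; inside; outside; _∈_; _∉_; _⊆_; ⊥; ⊤; ⁅_⁆; _─_; ∣_∣; Empty; Nonempty)
  renaming (_-_ to _∖_)
open import Data.Fin.Subset.Properties
  using ( _∈?_; _⊆?_; nonempty?; ∉⊥; ⊥⊆; ∈⊤; ∣⊤∣≡n; ∣p∣≤n; ∣p∣≤∣x∷p∣; ∣⊥∣≡0; ∣⁅x⁆∣≡1; Empty-unique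
        ; drop-∷-⊆; ⊆-antisym; x∈⁅y⁆⇒x≡y; x∉⁅y⁆⇒x≢y; x∈p∧x∉q⇒x∈p─q; x∈p∧x≢y⇒x∈p-y; x∈p∩q⁺
        ; p─q⊆p; p─⊥≡p; p∩q≢∅⇒∣p─q∣<∣p∣ )
open import Data.List as List using (List; []; _∷_; _++_; concatMap; allFin; upTo; applyUpTo)
open import Data.List.Properties using (map-upTo; upTo-∷ʳ)
open import Data.List.Membership.Propositional using () renaming (_∈_ to _∈ₗ_)
open import Data.List.Membership.Propositional.Properties
  using (∈-map⁺; ∈-filter⁺; ∈-filter⁻; ∈-allFin; ∈-cartesianProductWith⁺)
open import Data.List.Relation.Unary.Any using (here; there)
open import Data.List.Relation.Unary.All as All using ([]; _∷_)
open import Data.List.Relation.Unary.AllPairs using ([]; _∷_)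
open import Data.List.Relation.Unary.Unique.Propositional using (Unique)
import Data.List.Relation.Unary.Unique.Propositional.Properties as Unique
open import Data.Vec as Vec using (Vec; []; _∷_; lookup; _[_]≔_; here; there)
import Data.Vec.Properties as Vec
open import Relation.Binary.PropositionalEquality
  using (_≡_; _≢_; refl; sym; trans; cong; cong₂; subst; subst₂; module ≡-Reasoning)
open import Relation.Binary.Definitions using (DecidableEquality; tri<; tri≈; tri>)
open import Relation.Nullary using (Dec; yes; no; does; ¬_; ¬?)
open import Relation.Nullary.Decidable as Dec using (_×-dec_; _→-dec_)
open import Relation.Unary using (Decidable)

private variable
  a b p q : Level
  m : ℕ
  A B : Set a

∑ : List A → (A → ℤ) → ℤ
∑ []       f = 0ℤ
∑ (x ∷ xs) f = f x + ∑ xs f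

syntax ∑ xs (λ x → e) = ∑[ x ← xs ] e

-- Defined through `does` rather than by matching on yes/no, so that it computes on
-- decisions built by Dec.map′ such as `suc x ∈? (b ∷ p)`.
when : {P : Set p} → Dec P → ℤ → ℤ
when P? z = if does P? then z else 0ℤ

when-yes : {P : Set p} (P? : Dec P) → P → ∀ z → when P? z ≡ z
when-yes (yes _) _  z = refl
when-yes (no ¬P) pr z = ⊥-elim (¬P pr)

when-no : {P : Set p} (P? : Dec P) → ¬ P → ∀ z → when P? z ≡ 0ℤ
when-no (yes pr) ¬P z = ⊥-elim (¬P pr)
when-no (no _)   _  z = refl

when-⇔ : {P : Set p} {Q : Set q} (P? : Dec P) (Q? : Dec Q) → (P → Q) → (Q → P) →
         ∀ z → when P? z ≡ when Q? z
when-⇔ (yes _)  (yes _)  _ _ z = refl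
when-⇔ (yes pr) (no ¬Q)  f _ z = ⊥-elim (¬Q (f pr))
when-⇔ (no ¬P)  (yes qr) _ g z = ⊥-elim (¬P (g qr))
when-⇔ (no _)   (no _)   _ _ z = refl

when-cong : {P : Set p} (P? : Dec P) {y z : ℤ} → (P → y ≡ z) → when P? y ≡ when P? z
when-cong (yes pr) eq = eq pr
when-cong (no _)   _  = refl

when-× : {P : Set p} {Q : Set q} (P? : Dec P) (Q? : Dec Q) →
         ∀ z → when (P? ×-dec Q?) z ≡ when P? (when Q? z)
when-× (yes _) (yes _) z = refl
when-× (yes _) (no _)  z = refl
when-× (no _)  _       z = refl

when-0 : {P : Set p} (P? : Dec P) → when P? 0ℤ ≡ 0ℤ
when-0 (yes _) = refl
when-0 (no _)  = refl

when-*ˡ : {P : Set p} (P? : Dec P) → ∀ y z → when P? (y * z) ≡ y * when P? z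
when-*ˡ (yes _) y z = refl
when-*ˡ (no _)  y z = sym (ℤP.*-zeroʳ y)

when-¬ : {P : Set p} (P? : Dec P) → ∀ z → z ≡ when P? z + when (¬? P?) z
when-¬ (yes _) z = sym (ℤP.+-identityʳ z)
when-¬ (no _)  z = sym (ℤP.+-identityˡ z)

∑-cong : (xs : List A) {f g : A → ℤ} → (∀ x → f x ≡ g x) → ∑ xs f ≡ ∑ xs g
∑-cong []       eq = refl
∑-cong (x ∷ xs) eq = cong₂ _+_ (eq x) (∑-cong xs eq)

∑-zero : (xs : List A) {f : A → ℤ} → (∀ {x} → x ∈ₗ xs → f x ≡ 0ℤ) → ∑ xs f ≡ 0ℤ
∑-zero []       eq = refl
∑-zero (x ∷ xs) eq = cong₂ _+_ (eq (here refl)) (∑-zero xs (eq ∘ there))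

∑-+ : (xs : List A) (f g : A → ℤ) → ∑[ x ← xs ] (f x + g x) ≡ ∑ xs f + ∑ xs g
∑-+ []       f g = refl
∑-+ (x ∷ xs) f g = begin
  (f x + g x) + ∑[ y ← xs ] (f y + g y) ≡⟨ cong (_+_ (f x + g x)) (∑-+ xs f g) ⟩
  (f x + g x) + (∑ xs f + ∑ xs g)      ≡⟨ +-interchange (f x) (g x) (∑ xs f) (∑ xs g) ⟩
  (f x + ∑ xs f) + (g x + ∑ xs g)      ∎
  where
  open ≡-Reasoning
  +-interchange : ∀ a b c d → (a + b) + (c + d) ≡ (a + c) + (b + d)
  +-interchange = solve-∀

∑-*ˡ : (xs : List A) (c : ℤ) (f : A → ℤ) → ∑[ x ← xs ] (c * f x) ≡ c * ∑ xs f
∑-*ˡ []       c f = sym (ℤP.*-zeroʳ c)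
∑-*ˡ (x ∷ xs) c f = trans (cong (_+_ (c * f x)) (∑-*ˡ xs c f)) (sym (ℤP.*-distribˡ-+ c (f x) (∑ xs f)))

∑-++ : (xs ys : List A) (f : A → ℤ) → ∑ (xs ++ ys) f ≡ ∑ xs f + ∑ ys f
∑-++ []       ys f = sym (ℤP.+-identityˡ _)
∑-++ (x ∷ xs) ys f = trans (cong (_+_ (f x)) (∑-++ xs ys f)) (sym (ℤP.+-assoc (f x) _ _))

∑-map : (xs : List A) (h : A → B) (f : B → ℤ) → ∑ (List.map h xs) f ≡ ∑[ x ← xs ] f (h x)
∑-map []       h f = refl
∑-map (x ∷ xs) h f = cong (_+_ (f (h x))) (∑-map xs h f)

∑-concatMap : (xs : List A) (h : A → List B) (f : B → ℤ) →
              ∑ (concatMap h xs) f ≡ ∑[ x ← xs ] ∑ (h x) f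
∑-concatMap []       h f = refl
∑-concatMap (x ∷ xs) h f =
  trans (∑-++ (h x) (concatMap h xs) f) (cong (_+_ (∑ (h x) f)) (∑-concatMap xs h f))

∑-swap : (xs : List A) (ys : List B) (f : A → B → ℤ) →
         ∑[ x ← xs ] ∑[ y ← ys ] f x y ≡ ∑[ y ← ys ] ∑[ x ← xs ] f x y
∑-swap []       ys f = sym (∑-zero ys (λ _ → refl))
∑-swap (x ∷ xs) ys f =
  trans (cong (_+_ (∑ ys (f x))) (∑-swap xs ys f)) (sym (∑-+ ys (f x) (λ y → ∑[ x ← xs ] f x y)))

∑-when : (xs : List A) {P : Set p} (P? : Dec P) (f : A → ℤ) →
         ∑[ x ← xs ] when P? (f x) ≡ when P? (∑ xs f)
∑-when xs (yes _) f = refl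
∑-when xs (no _)  f = ∑-zero xs (λ _ → refl)

∑-count : (xs : List A) {P : A → Set p} (P? : Decidable P) → ∑[ x ← xs ] when (P? x) 1ℤ ≡ + count P? xs
∑-count []       P? = refl
∑-count (x ∷ xs) P? with P? x
... | yes _ = trans (cong (_+_ 1ℤ) (∑-count xs P?)) (ℤP.pos-+ 1 (count P? xs))
... | no _  = trans (ℤP.+-identityˡ _) (∑-count xs P?)

∑-unique : (xs : List A) → Unique xs → {m : A} → m ∈ₗ xs →
           {M : A → Set p} (M? : Decidable M) → M m → (∀ {y} → M y → y ≡ m) →
           (f : A → ℤ) → ∑[ y ← xs ] when (M? y) (f y) ≡ f m
∑-unique (x ∷ xs) (x∉xs ∷ u) m∈ M? Mm M⇒≡m f with M? x
... | yes Mx with M⇒≡m Mx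
...   | refl = trans (cong (_+_ (f x)) (∑-zero xs others)) (ℤP.+-identityʳ (f x))
  where
  others : ∀ {y} → y ∈ₗ xs → when (M? y) (f y) ≡ 0ℤ
  others y∈ = when-no (M? _) (λ My → All.lookup x∉xs y∈ (sym (M⇒≡m My))) _
∑-unique (x ∷ xs) (x∉xs ∷ u) (here refl)  M? Mm M⇒≡m f | no ¬Mx = ⊥-elim (¬Mx Mm)
∑-unique (x ∷ xs) (x∉xs ∷ u) (there m∈) M? Mm M⇒≡m f | no ¬Mx =
  trans (ℤP.+-identityˡ _) (∑-unique xs u m∈ M? Mm M⇒≡m f)

∑-fibres : {A : Set a} {Y : Set b} {P : A → Set p} {M : Y → A → Set q} →
           (xs : List A) (ys : List Y) → Unique ys → (∀ y → y ∈ₗ ys) →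
           (P? : Decidable P) (M? : ∀ y → Decidable (M y)) →
           (∀ {x} → P x → ∃ λ y → M y x × (∀ {y′} → M y′ x → y′ ≡ y)) → (∀ {y x} → M y x → P x) →
           (g : A → ℤ) → ∑[ x ← xs ] when (P? x) (g x) ≡ ∑[ y ← ys ] ∑[ x ← xs ] when (M? y x) (g x)
∑-fibres {P = P} xs ys ys! ∈ys P? M? fibre M⇒P g =
  trans (∑-cong xs (λ x → split x (P? x))) (∑-swap xs ys (λ x y → when (M? y x) (g x)))
  where
  split : ∀ x → (P? : Dec (P x)) → when P? (g x) ≡ ∑[ y ← ys ] when (M? y x) (g x)
  split x (yes Px) with fibre Px
  ... | y , Myx , unique = sym (∑-unique ys ys! (∈ys y) (λ y → M? y x) Myx unique (λ _ → g x))
  split x (no ¬Px) = sym (∑-zero ys (λ _ → when-no (M? _ x) (¬Px ∘ M⇒P) (g x)))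

∑-upTo-suc : ∀ k (g : ℕ → ℤ) → ∑ (upTo (suc k)) g ≡ g 0 + ∑[ i ← upTo k ] g (suc i)
∑-upTo-suc k g = cong (_+_ (g 0)) (begin
  ∑ (applyUpTo suc k) g      ≡⟨ cong (λ is → ∑ is g) (map-upTo suc k) ⟨
  ∑ (List.map suc (upTo k)) g ≡⟨ ∑-map (upTo k) suc g ⟩
  ∑[ i ← upTo k ] g (suc i)  ∎)
  where open ≡-Reasoning

∑-upTo-last : ∀ k (g : ℕ → ℤ) → ∑ (upTo (suc k)) g ≡ ∑ (upTo k) g + g k
∑-upTo-last k g = begin
  ∑ (upTo (suc k)) g          ≡⟨ cong (λ is → ∑ is g) (upTo-∷ʳ k) ⟨
  ∑ (upTo k ++ k ∷ []) g      ≡⟨ ∑-++ (upTo k) (k ∷ []) g ⟩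
  ∑ (upTo k) g + (g k + 0ℤ)   ≡⟨ cong (_+_ (∑ (upTo k) g)) (ℤP.+-identityʳ (g k)) ⟩
  ∑ (upTo k) g + g k          ∎
  where open ≡-Reasoning

count-bijection : {A : Set a} {B : Set b} {P : A → Set p} {Q : B → Set q} (P? : Decidable P) (Q? : Decidable Q) →
                  DecidableEquality B → {xs : List A} {ys : List B} →
                  Unique xs → Unique ys → (∀ x → x ∈ₗ xs) → (∀ y → y ∈ₗ ys) →
                  (f : A → B) → (∀ {x} → P x → Q (f x)) →
                  (∀ {x x′} → P x → P x′ → f x ≡ f x′ → x ≡ x′) →
                  (∀ {y} → Q y → ∃ λ x → P x × f x ≡ y) →
                  count P? xs ≡ count Q? ys
count-bijection {A = A} {B = B} {Q = Q} P? Q? _≟_ {xs} {ys} xs! ys! ∈xs ∈ys f f-pres f-inj f-surj =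
  ℤP.+-injective (begin
    + count P? xs                                        ≡⟨ ∑-count xs P? ⟨
    ∑[ x ← xs ] when (P? x) 1ℤ                           ≡⟨ ∑-cong xs (λ x → cong (when (P? x)) (sym (fibre x))) ⟩
    ∑[ x ← xs ] when (P? x) (∑[ y ← ys ] is-image x y)   ≡⟨ ∑-cong xs (λ x → ∑-when ys (P? x) (is-image x)) ⟨
    ∑[ x ← xs ] ∑[ y ← ys ] when (P? x) (is-image x y)   ≡⟨ ∑-swap xs ys _ ⟩
    ∑[ y ← ys ] ∑[ x ← xs ] when (P? x) (is-image x y)   ≡⟨ ∑-cong ys preimage ⟩
    ∑[ y ← ys ] when (Q? y) 1ℤ                           ≡⟨ ∑-count ys Q? ⟩
    + count Q? ys                                        ∎)
  where
  open ≡-Reasoning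
  is-image : A → B → ℤ
  is-image x y = when (f x ≟ y) 1ℤ
  fibre : ∀ x → ∑[ y ← ys ] is-image x y ≡ 1ℤ
  fibre x = ∑-unique ys ys! (∈ys (f x)) (f x ≟_) refl sym (λ _ → 1ℤ)
  preimage : ∀ y → ∑[ x ← xs ] when (P? x) (is-image x y) ≡ when (Q? y) 1ℤ
  preimage y = trans (∑-cong xs (λ x → sym (when-× (P? x) (f x ≟ y) 1ℤ))) (count-preimage (Q? y))
    where
    count-preimage : Dec (Q y) → ∑[ x ← xs ] when (P? x ×-dec (f x ≟ y)) 1ℤ ≡ when (Q? y) 1ℤ
    count-preimage (yes Qy) with f-surj Qy
    ... | x₀ , Px₀ , refl = trans
      (∑-unique xs xs! (∈xs x₀) (λ x → P? x ×-dec (f x ≟ y)) (Px₀ , refl)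
                (λ (Px , fx≡y) → f-inj Px Px₀ fx≡y) (λ _ → 1ℤ))
      (sym (when-yes (Q? y) Qy 1ℤ))
    count-preimage (no ¬Qy) = trans
      (∑-zero xs (λ {x} _ → when-no (P? x ×-dec (f x ≟ y)) (λ (Px , fx≡y) → ¬Qy (subst Q fx≡y (f-pres Px))) 1ℤ))
      (sym (when-no (Q? y) ¬Qy 1ℤ))

allVecs-suc : (xs : List A) (k : ℕ) →
              allVecs xs (suc k) ≡ List.cartesianProductWith _∷_ xs (allVecs xs k)
allVecs-suc xs k = concatMap≡cartesianProduct xs
  where
  concatMap≡cartesianProduct : ∀ ys → concatMap (λ x → List.map (x ∷_) (allVecs xs k)) ys
                                      ≡ List.cartesianProductWith _∷_ ys (allVecs xs k)
  concatMap≡cartesianProduct []       = refl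
  concatMap≡cartesianProduct (y ∷ ys) = cong (List.map (y ∷_) (allVecs xs k) ++_) (concatMap≡cartesianProduct ys)

∈-allVecs : (xs : List A) {k : ℕ} (v : Vec A k) → (∀ i → lookup v i ∈ₗ xs) → v ∈ₗ allVecs xs k
∈-allVecs xs []      _  = here refl
∈-allVecs xs (x ∷ v) ∈xs = subst (x ∷ v ∈ₗ_) (sym (allVecs-suc xs _))
  (∈-cartesianProductWith⁺ _∷_ (∈xs zero) (∈-allVecs xs v (∈xs ∘ suc)))

allVecs⁺ : (xs : List A) → Unique xs → ∀ k → Unique (allVecs xs k)
allVecs⁺ xs xs! zero    = [] ∷ []
allVecs⁺ xs xs! (suc k) = subst Unique (sym (allVecs-suc xs k))
  (Unique.cartesianProductWith⁺ _∷_ Vec.∷-injective xs! (allVecs⁺ xs xs! k))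

lookup-ext : ∀ {k} {u v : Vec A k} → (∀ i → lookup u i ≡ lookup v i) → u ≡ v
lookup-ext {u = u} {v} eq = begin
  u                    ≡⟨ Vec.tabulate∘lookup u ⟨
  Vec.tabulate (lookup u) ≡⟨ Vec.tabulate-cong eq ⟩
  Vec.tabulate (lookup v) ≡⟨ Vec.tabulate∘lookup v ⟩
  v                    ∎
  where open ≡-Reasoning

bools : List Bool
bools = true ∷ false ∷ []

allSubsets⁺ : ∀ m → Unique (allSubsets m)
allSubsets⁺ = allVecs⁺ bools (((λ ()) ∷ []) ∷ [] ∷ [])

∈-allSubsets : (p : Subset m) → p ∈ₗ allSubsets m
∈-allSubsets p = ∈-allVecs bools p (λ i → ∈-bools (lookup p i))
  where
  ∈-bools : ∀ b → b ∈ₗ bools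
  ∈-bools true  = here refl
  ∈-bools false = there (here refl)

x∈p─q⁻ : ∀ {x : Fin m} p q → x ∈ p ─ q → x ∈ p × x ∉ q
x∈p─q⁻ (s ∷ p) (outside ∷ q) here      = here , λ ()
x∈p─q⁻ (s ∷ p) (t ∷ q)       (there i) with x∈p─q⁻ p q i
... | x∈p , x∉q = there x∈p , λ { (there x∈q) → x∉q x∈q }

x∈p-y⁻ : ∀ {x y : Fin m} p → x ∈ p ∖ y → x ∈ p × x ≢ y
x∈p-y⁻ {y = y} p x∈ with x∈p─q⁻ p ⁅ y ⁆ x∈
... | x∈p , x∉⁅y⁆ = x∈p , x∉⁅y⁆⇒x≢y x∉⁅y⁆

∣q∣+∣p─q∣≡∣p∣ : ∀ (p q : Subset m) → q ⊆ p → ∣ q ∣ ℕ.+ ∣ p ─ q ∣ ≡ ∣ p ∣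
∣q∣+∣p─q∣≡∣p∣ []            []            _   = refl
∣q∣+∣p─q∣≡∣p∣ (inside ∷ p)  (inside ∷ q)  q⊆p = cong suc (∣q∣+∣p─q∣≡∣p∣ p q (drop-∷-⊆ q⊆p))
∣q∣+∣p─q∣≡∣p∣ (outside ∷ p) (inside ∷ q)  q⊆p with () ← q⊆p here
∣q∣+∣p─q∣≡∣p∣ (inside ∷ p)  (outside ∷ q) q⊆p =
  trans (ℕP.+-suc ∣ q ∣ ∣ p ─ q ∣) (cong suc (∣q∣+∣p─q∣≡∣p∣ p q (drop-∷-⊆ q⊆p)))
∣q∣+∣p─q∣≡∣p∣ (outside ∷ p) (outside ∷ q) q⊆p = ∣q∣+∣p─q∣≡∣p∣ p q (drop-∷-⊆ q⊆p)

∣p∣≡1+k⇒∣p-x∣≡k : ∀ {p : Subset m} {x k} → x ∈ p → ∣ p ∣ ≡ suc k → ∣ p ∖ x ∣ ≡ k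
∣p∣≡1+k⇒∣p-x∣≡k {p = p} {x} x∈p ∣p∣≡1+k = ℕP.suc-injective (begin
  suc ∣ p ∖ x ∣               ≡⟨ cong (ℕ._+ ∣ p ∖ x ∣) (∣⁅x⁆∣≡1 x) ⟨
  ∣ ⁅ x ⁆ ∣ ℕ.+ ∣ p ∖ x ∣     ≡⟨ ∣q∣+∣p─q∣≡∣p∣ p ⁅ x ⁆ ⁅x⁆⊆p ⟩
  ∣ p ∣                      ≡⟨ ∣p∣≡1+k ⟩
  suc _                      ∎)
  where
  open ≡-Reasoning
  ⁅x⁆⊆p : ⁅ x ⁆ ⊆ p
  ⁅x⁆⊆p y∈⁅x⁆ = subst (_∈ p) (sym (x∈⁅y⁆⇒x≡y x y∈⁅x⁆)) x∈p

x∈p⇒∣p∣>0 : ∀ {x : Fin m} {p} → x ∈ p → 0 < ∣ p ∣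
x∈p⇒∣p∣>0 {p = inside ∷ p} here      = s≤s z≤n
x∈p⇒∣p∣>0 {p = s ∷ p}      (there i) = ℕP.<-≤-trans (x∈p⇒∣p∣>0 i) (∣p∣≤∣x∷p∣ s p)

Empty⇒∣p∣≡0 : ∀ {p : Subset m} → Empty p → ∣ p ∣ ≡ 0
Empty⇒∣p∣≡0 {m} empty rewrite Empty-unique empty = ∣⊥∣≡0 m

∣p∣≡0⇒Empty : ∀ {p : Subset m} → ∣ p ∣ ≡ 0 → Empty p
∣p∣≡0⇒Empty ∣p∣≡0 (x , x∈p) = ℕP.<-irrefl (sym ∣p∣≡0) (x∈p⇒∣p∣>0 x∈p)

∣p∣>0⇒Nonempty : ∀ {p : Subset m} → 0 < ∣ p ∣ → Nonempty p
∣p∣>0⇒Nonempty {p = p} ∣p∣>0 with nonempty? p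
... | yes nonempty = nonempty
... | no  empty    = ⊥-elim (ℕP.<-irrefl (sym (Empty⇒∣p∣≡0 empty)) ∣p∣>0)

empty? : (S : Subset m) → Dec (Empty S)
empty? S = ¬? (nonempty? S)

minimum : ∀ (p : Subset m) → Nonempty p → ∃ λ x → x ∈ p × (∀ {y} → y ∈ p → x Fin.≤ y)
minimum (inside  ∷ p) _                = zero , here , λ _ → z≤n
minimum (outside ∷ p) (suc x , there i) with minimum p (x , i)
... | y , y∈p , y≤ = suc y , there y∈p , λ { (there z∈p) → s≤s (y≤ z∈p) }

insert : Fin m → Subset m → Subset m
insert x p = p [ x ]≔ inside

x∈insert : ∀ (x : Fin m) p → x ∈ insert x p
x∈insert x p = Vec.lookup⇒[]= x (insert x p) (Vec.lookup∘update x p inside)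

∈-insert⁺ : ∀ {x y : Fin m} p → y ∈ p → y ∈ insert x p
∈-insert⁺ {x = x} {y} p y∈p with y FinP.≟ x
... | yes refl = x∈insert x p
... | no  y≢x  = Vec.lookup⇒[]= y (insert x p)
  (trans (Vec.lookup∘update′ y≢x p inside) (Vec.[]=⇒lookup y∈p))

∈-insert⁻ : ∀ {x y : Fin m} p → y ∈ insert x p → y ≢ x → y ∈ p
∈-insert⁻ {x = x} {y} p y∈ y≢x = Vec.lookup⇒[]= y p
  (trans (sym (Vec.lookup∘update′ y≢x p inside)) (Vec.[]=⇒lookup y∈))

p─insert≡p-x─q : ∀ (p q : Subset m) x → p ─ insert x q ≡ p ∖ x ─ q
p─insert≡p-x─q p q x = ⊆-antisym to from
  where
  to : p ─ insert x q ⊆ p ∖ x ─ q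
  to y∈ with x∈p─q⁻ p (insert x q) y∈
  ... | y∈p , y∉ = x∈p∧x∉q⇒x∈p─q (x∈p∧x≢y⇒x∈p-y y∈p λ { refl → y∉ (x∈insert x q) }) (y∉ ∘ ∈-insert⁺ q)
  from : p ∖ x ─ q ⊆ p ─ insert x q
  from y∈ with x∈p─q⁻ (p ∖ x) q y∈
  ... | y∈p-x , y∉q with x∈p-y⁻ p y∈p-x
  ...   | y∈p , y≢x = x∈p∧x∉q⇒x∈p─q y∈p (λ y∈ins → y∉q (∈-insert⁻ q y∈ins y≢x))

∑-allSubsets-suc : (h : Subset (suc m) → ℤ) →
                   ∑ (allSubsets (suc m)) h ≡ ∑[ p ← allSubsets m ] (h (inside ∷ p) + h (outside ∷ p))
∑-allSubsets-suc {m} h = begin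
  ∑ (allSubsets (suc m)) h
    ≡⟨ ∑-++ (List.map (inside ∷_) ps) (List.map (outside ∷_) ps ++ []) h ⟩
  ∑ (List.map (inside ∷_) ps) h + ∑ (List.map (outside ∷_) ps ++ []) h
    ≡⟨ cong (_+_ (∑ (List.map (inside ∷_) ps) h))
            (trans (∑-++ (List.map (outside ∷_) ps) [] h) (ℤP.+-identityʳ _)) ⟩
  ∑ (List.map (inside ∷_) ps) h + ∑ (List.map (outside ∷_) ps) h
    ≡⟨ cong₂ _+_ (∑-map ps (inside ∷_) h) (∑-map ps (outside ∷_) h) ⟩
  ∑[ p ← ps ] h (inside ∷ p) + ∑[ p ← ps ] h (outside ∷ p)
    ≡⟨ ∑-+ ps _ _ ⟨
  ∑[ p ← ps ] (h (inside ∷ p) + h (outside ∷ p)) ∎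
  where
  open ≡-Reasoning
  ps : List (Subset m)
  ps = allSubsets m

∑-split-at : (x : Fin m) (h : Subset m → ℤ) →
             ∑ (allSubsets m) h ≡ ∑[ p ← allSubsets m ] when (¬? (x ∈? p)) (h p + h (insert x p))
∑-split-at {suc m} zero h = begin
  ∑ (allSubsets (suc m)) h                              ≡⟨ ∑-allSubsets-suc h ⟩
  ∑[ p ← ps ] (h (inside ∷ p) + h (outside ∷ p))        ≡⟨ ∑-cong ps (λ p → swap (h (inside ∷ p)) (h (outside ∷ p))) ⟩
  ∑[ p ← ps ] (0ℤ + (h (outside ∷ p) + h (inside ∷ p))) ≡⟨ ∑-allSubsets-suc split ⟨
  ∑[ p ← allSubsets (suc m) ] split p                   ∎
  where
  open ≡-Reasoning
  ps : List (Subset m)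
  ps = allSubsets m
  split : Subset (suc m) → ℤ
  split p = when (¬? (zero ∈? p)) (h p + h (insert zero p))
  swap : ∀ a b → a + b ≡ 0ℤ + (b + a)
  swap = solve-∀
∑-split-at {suc m} (suc x) h = begin
  ∑ (allSubsets (suc m)) h                                 ≡⟨ ∑-allSubsets-suc h ⟩
  ∑[ p ← ps ] (h (inside ∷ p) + h (outside ∷ p))           ≡⟨ ∑-+ ps _ _ ⟩
  ∑[ p ← ps ] h (inside ∷ p) + ∑[ p ← ps ] h (outside ∷ p) ≡⟨ cong₂ _+_ (∑-split-at x (h ∘ (inside ∷_)))
                                                                          (∑-split-at x (h ∘ (outside ∷_))) ⟩
  ∑ ps (split inside) + ∑ ps (split outside)               ≡⟨ ∑-+ ps (split inside) (split outside) ⟨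
  ∑[ p ← ps ] (split inside p + split outside p)           ≡⟨ ∑-allSubsets-suc split′ ⟨
  ∑[ p ← allSubsets (suc m) ] split′ p                     ∎
  where
  open ≡-Reasoning
  ps : List (Subset m)
  ps = allSubsets m
  split : Bool → Subset m → ℤ
  split b p = when (¬? (x ∈? p)) (h (b ∷ p) + h (b ∷ insert x p))
  split′ : Subset (suc m) → ℤ
  split′ p = when (¬? (suc x ∈? p)) (h p + h (insert (suc x) p))

∑-split-⊥ : {P : Subset m → Set p} (P? : Decidable P) → P ⊥ → (f : Subset m → ℤ) →
            ∑[ B ← allSubsets m ] when (P? B) (f B)
            ≡ f ⊥ + ∑[ B ← allSubsets m ] when (nonempty? B ×-dec P? B) (f B)
∑-split-⊥ {m} {P = P} P? P⊥ f = begin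
  ∑[ B ← allSubsets m ] when (P? B) (f B)
    ≡⟨ ∑-cong (allSubsets m) split ⟩
  ∑[ B ← allSubsets m ] (when (B ≟⊥) (f B) + when (nonempty? B ×-dec P? B) (f B))
    ≡⟨ ∑-+ (allSubsets m) _ _ ⟩
  ∑[ B ← allSubsets m ] when (B ≟⊥) (f B) + rest
    ≡⟨ cong (_+ rest) (∑-unique (allSubsets m) (allSubsets⁺ m) (∈-allSubsets ⊥) _≟⊥ refl id f) ⟩
  f ⊥ + rest ∎
  where
  open ≡-Reasoning
  rest : ℤ
  rest = ∑[ B ← allSubsets m ] when (nonempty? B ×-dec P? B) (f B)
  _≟⊥ : (B : Subset m) → Dec (B ≡ ⊥)
  B ≟⊥ = Vec.≡-dec Bool._≟_ B ⊥
  split : ∀ B → when (P? B) (f B) ≡ when (B ≟⊥) (f B) + when (nonempty? B ×-dec P? B) (f B)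
  split B with B ≟⊥
  ... | yes refl = trans (when-yes (P? ⊥) P⊥ (f ⊥)) (trans (sym (ℤP.+-identityʳ (f ⊥)))
    (cong (_+_ (f ⊥)) (sym (when-no (nonempty? (⊥ {n = m}) ×-dec P? ⊥) (λ ((_ , x∈⊥) , _) → ∉⊥ x∈⊥) (f ⊥)))))
  ... | no B≢⊥ = trans (when-⇔ (P? B) (nonempty? B ×-dec P? B) (nonempty ,_) proj₂ (f B)) (sym (ℤP.+-identityˡ _))
    where
    nonempty : Nonempty B
    nonempty with nonempty? B
    ... | yes ne    = ne
    ... | no  empty = ⊥-elim (B≢⊥ (Empty-unique empty))

-- Binomial coefficients at integer arguments

[q*d]/d≡q : ∀ q d .{{_ : ℕ.NonZero d}} → (q * + d) / + d ≡ q
[q*d]/d≡q q (suc d) = trans (ℤP.*-identityˡ _) (exact q)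
  where
  exact : ∀ q → (q * + suc d) /ℕ suc d ≡ q
  exact (+ m)    rewrite sym (ℤP.pos-* m (suc d)) = cong +_ (ℕD.m*n/n≡m m (suc d) {{_}})
  exact -[1+ m ] rewrite ℕD.m*n%n≡0 (suc m) (suc d) {{_}} | ℕD.m*n/n≡m (suc m) (suc d) {{_}} = refl

binomℤ-exact : ∀ t k q → fallingℤ t k ≡ q * + (k !) → binomℤ t k ≡ q
binomℤ-exact t k q eq rewrite eq = [q*d]/d≡q q (k !) {{k ℕP.!≢0}}

binomℤ-zero : ∀ t → binomℤ t 0 ≡ 1ℤ
binomℤ-zero t = binomℤ-exact t 0 1ℤ refl

fallingℤ-0-suc : ∀ k → fallingℤ 0ℤ (suc k) ≡ 0ℤ
fallingℤ-0-suc zero    = refl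
fallingℤ-0-suc (suc k) rewrite fallingℤ-0-suc k = refl

binomℤ-0-suc : ∀ k → binomℤ 0ℤ (suc k) ≡ 0ℤ
binomℤ-0-suc k = binomℤ-exact 0ℤ (suc k) 0ℤ (fallingℤ-0-suc k)

fallingℤ-1+ : ∀ t k → fallingℤ (1ℤ + t) (suc k) ≡ (1ℤ + t) * fallingℤ t k
fallingℤ-1+ t zero    = base (1ℤ + t)
  where
  base : ∀ a → 1ℤ * (a - 0ℤ) ≡ a * 1ℤ
  base = solve-∀
fallingℤ-1+ t (suc k) rewrite fallingℤ-1+ t k = shift (1ℤ + t) (fallingℤ t k) t (+ k)
  where
  shift : ∀ a f t k → (a * f) * ((1ℤ + t) - (1ℤ + k)) ≡ a * (f * (t - k))
  shift = solve-∀

fallingℤ-pascal : ∀ t k → fallingℤ (1ℤ + t) (suc k) ≡ fallingℤ t (suc k) + (+ suc k) * fallingℤ t k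
fallingℤ-pascal t k rewrite fallingℤ-1+ t k = split t (fallingℤ t k) (+ k)
  where
  split : ∀ t f k → (1ℤ + t) * f ≡ f * (t - k) + (1ℤ + k) * f
  split = solve-∀

-- Makes the division in binomℤ exact; it is established for t ∈ ℕ and for t = −1 only.
FallingDivisible : ℤ → Set
FallingDivisible t = ∀ k → ∃ λ q → fallingℤ t k ≡ q * + (k !)

fallingℤ-pascal-quotient : ∀ t k {q₁ q₀} → fallingℤ t (suc k) ≡ q₁ * + (suc k !) → fallingℤ t k ≡ q₀ * + (k !) →
                           fallingℤ (1ℤ + t) (suc k) ≡ (q₁ + q₀) * + (suc k !)
fallingℤ-pascal-quotient t k {q₁} {q₀} eq₁ eq₀ = begin
  fallingℤ (1ℤ + t) (suc k)                              ≡⟨ fallingℤ-pascal t k ⟩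
  fallingℤ t (suc k) + (+ suc k) * fallingℤ t k          ≡⟨ cong₂ (λ a b → a + (+ suc k) * b) eq₁ eq₀ ⟩
  q₁ * + (suc k !) + (+ suc k) * (q₀ * + (k !))
    ≡⟨ cong (λ f → q₁ * f + (+ suc k) * (q₀ * + (k !))) (ℤP.pos-* (suc k) (k !)) ⟩
  q₁ * ((+ suc k) * + (k !)) + (+ suc k) * (q₀ * + (k !)) ≡⟨ collect q₁ q₀ (+ suc k) (+ (k !)) ⟩
  (q₁ + q₀) * ((+ suc k) * + (k !))                      ≡⟨ cong ((q₁ + q₀) *_) (ℤP.pos-* (suc k) (k !)) ⟨
  (q₁ + q₀) * + (suc k !)                                ∎
  where
  open ≡-Reasoning
  collect : ∀ a b c d → a * (c * d) + c * (b * d) ≡ (a + b) * (c * d)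
  collect = solve-∀

fallingDivisible-1+ : ∀ {t} → FallingDivisible t → FallingDivisible (1ℤ + t)
fallingDivisible-1+ div zero = 1ℤ , refl
fallingDivisible-1+ {t} div (suc k) with div (suc k) | div k
... | q₁ , eq₁ | q₀ , eq₀ = q₁ + q₀ , fallingℤ-pascal-quotient t k {q₁} {q₀} eq₁ eq₀

fallingDivisible-ℕ : ∀ m → FallingDivisible (+ m)
fallingDivisible-ℕ zero    zero    = 1ℤ , refl
fallingDivisible-ℕ zero    (suc k) = 0ℤ , fallingℤ-0-suc k
fallingDivisible-ℕ (suc m) = fallingDivisible-1+ (fallingDivisible-ℕ m)

fallingDivisible-−1 : FallingDivisible (- 1ℤ)
fallingDivisible-−1 zero    = 1ℤ , refl
fallingDivisible-−1 (suc k) with fallingDivisible-−1 k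
... | q , eq = - q , (begin
  fallingℤ (- 1ℤ) k * (- 1ℤ - + k)   ≡⟨ cong (_* (- 1ℤ - + k)) eq ⟩
  q * + (k !) * (- 1ℤ - + k)         ≡⟨ negate q (+ k) (+ (k !)) ⟩
  - q * ((+ suc k) * + (k !))        ≡⟨ cong (- q *_) (ℤP.pos-* (suc k) (k !)) ⟨
  - q * + (suc k !)                  ∎)
  where
  open ≡-Reasoning
  negate : ∀ q k f → q * f * (- 1ℤ - k) ≡ - q * ((1ℤ + k) * f)
  negate = solve-∀

binomℤ-pascal : ∀ {t} → FallingDivisible t → ∀ k → binomℤ (1ℤ + t) (suc k) ≡ binomℤ t (suc k) + binomℤ t k
binomℤ-pascal {t} div k with div (suc k) | div k
... | q₁ , eq₁ | q₀ , eq₀ = begin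
  binomℤ (1ℤ + t) (suc k)
    ≡⟨ binomℤ-exact (1ℤ + t) (suc k) (q₁ + q₀) (fallingℤ-pascal-quotient t k {q₁} {q₀} eq₁ eq₀) ⟩
  q₁ + q₀                        ≡⟨ cong₂ _+_ (binomℤ-exact t (suc k) q₁ eq₁) (binomℤ-exact t k q₀ eq₀) ⟨
  binomℤ t (suc k) + binomℤ t k  ∎
  where open ≡-Reasoning

-- Ordered partitions into blocks

module _ {Block : Subset m → Set} (Block? : Decidable Block) where

  OrderedPartition : ∀ {ℓ} → Subset m → Vec (Subset m) ℓ → Set
  OrderedPartition S []       = Empty S
  OrderedPartition S (B ∷ Bs) = (Block B × B ⊆ S) × OrderedPartition (S ─ B) Bs

  orderedPartition? : ∀ {ℓ} S (Bs : Vec (Subset m) ℓ) → Dec (OrderedPartition S Bs)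
  orderedPartition? S []       = empty? S
  orderedPartition? S (B ∷ Bs) = (Block? B ×-dec B ⊆? S) ×-dec orderedPartition? (S ─ B) Bs

  partitions : ℕ → Subset m → ℤ
  partitions ℓ S = ∑[ Bs ← allVecs (allSubsets m) ℓ ] when (orderedPartition? S Bs) 1ℤ

  partitions-zero : ∀ S → partitions 0 S ≡ when (empty? S) 1ℤ
  partitions-zero S = ℤP.+-identityʳ _

  partitions-suc : ∀ ℓ S → partitions (suc ℓ) S ≡
                   ∑[ B ← allSubsets m ] when (Block? B ×-dec B ⊆? S) (partitions ℓ (S ─ B))
  partitions-suc ℓ S = trans (∑-concatMap (allSubsets m) (λ B → List.map (B ∷_) Bss) _)
    (∑-cong (allSubsets m) λ B → begin
      ∑ (List.map (B ∷_) Bss) (λ Bs → when (orderedPartition? S Bs) 1ℤ)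
        ≡⟨ ∑-map Bss (B ∷_) _ ⟩
      ∑[ Bs ← Bss ] when (orderedPartition? S (B ∷ Bs)) 1ℤ
        ≡⟨ ∑-cong Bss (λ Bs → when-× (Block? B ×-dec B ⊆? S) (orderedPartition? (S ─ B) Bs) 1ℤ) ⟩
      ∑[ Bs ← Bss ] when (Block? B ×-dec B ⊆? S) (when (orderedPartition? (S ─ B) Bs) 1ℤ)
        ≡⟨ ∑-when Bss (Block? B ×-dec B ⊆? S) _ ⟩
      when (Block? B ×-dec B ⊆? S) (partitions ℓ (S ─ B)) ∎)
    where
    open ≡-Reasoning
    Bss : List (Vec (Subset m) ℓ)
    Bss = allVecs (allSubsets m) ℓ

  sum-sizes : ∀ {ℓ} S (Bs : Vec (Subset m) ℓ) → OrderedPartition S Bs → Vec.sum (Vec.map ∣_∣ Bs) ≡ ∣ S ∣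
  sum-sizes S []       empty                  = sym (Empty⇒∣p∣≡0 empty)
  sum-sizes S (B ∷ Bs) ((_ , B⊆S) , Bs-part) =
    trans (cong (∣ B ∣ ℕ.+_) (sum-sizes (S ─ B) Bs Bs-part)) (∣q∣+∣p─q∣≡∣p∣ S B B⊆S)

  record IsPartition {ℓ} (S : Subset m) (Bs : Vec (Subset m) ℓ) : Set where
    field
      disjoint : PairwiseDisjoint Bs
      covering : ∀ {x} → x ∈ S → ∃ λ k → x ∈ lookup Bs k
      within   : ∀ k → lookup Bs k ⊆ S
      blocks   : ∀ k → Block (lookup Bs k)

  orderedPartition⇒isPartition : ∀ {ℓ} S (Bs : Vec (Subset m) ℓ) → OrderedPartition S Bs → IsPartition S Bs
  orderedPartition⇒isPartition S [] empty = record
    { disjoint = λ ()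
    ; covering = λ x∈S → ⊥-elim (empty (_ , x∈S))
    ; within   = λ ()
    ; blocks   = λ ()
    }
  orderedPartition⇒isPartition S (B ∷ Bs) ((block , B⊆S) , Bs-part) = record
    { disjoint = disjoint′
    ; covering = covering′
    ; within   = λ { zero → B⊆S ; (suc k) → p─q⊆p S B ∘ within k }
    ; blocks   = λ { zero → block ; (suc k) → blocks k }
    }
    where
    open IsPartition (orderedPartition⇒isPartition (S ─ B) Bs Bs-part)
    disjoint′ : PairwiseDisjoint (B ∷ Bs)
    disjoint′ zero    zero     0≢0 = ⊥-elim (0≢0 refl)
    disjoint′ zero    (suc k)  _   x x∈B x∈Bₖ = proj₂ (x∈p─q⁻ S B (within k x∈Bₖ)) x∈B
    disjoint′ (suc k) zero     _   x x∈Bₖ x∈B = proj₂ (x∈p─q⁻ S B (within k x∈Bₖ)) x∈B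
    disjoint′ (suc k) (suc k′) k≢k′ = disjoint k k′ (k≢k′ ∘ cong suc)
    covering′ : ∀ {x} → x ∈ S → ∃ λ k → x ∈ lookup (B ∷ Bs) k
    covering′ {x} x∈S with x ∈? B
    ... | yes x∈B = zero , x∈B
    ... | no  x∉B = Product.map suc id (covering (x∈p∧x∉q⇒x∈p─q x∈S x∉B))

  isPartition⇒orderedPartition : ∀ {ℓ} S (Bs : Vec (Subset m) ℓ) → IsPartition S Bs → OrderedPartition S Bs
  isPartition⇒orderedPartition S [] part (x , x∈S) with () ← proj₁ (IsPartition.covering part x∈S)
  isPartition⇒orderedPartition S (B ∷ Bs) part =
    (blocks zero , within zero) , isPartition⇒orderedPartition (S ─ B) Bs (record
      { disjoint = λ k k′ k≢k′ → disjoint (suc k) (suc k′) (k≢k′ ∘ FinP.suc-injective)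
      ; covering = covering′
      ; within   = λ k x∈Bₖ → x∈p∧x∉q⇒x∈p─q (within (suc k) x∈Bₖ) (λ x∈B → disjoint zero (suc k) (λ ()) _ x∈B x∈Bₖ)
      ; blocks   = blocks ∘ suc
      })
    where
    open IsPartition part
    covering′ : ∀ {x} → x ∈ S ─ B → ∃ λ k → x ∈ lookup Bs k
    covering′ x∈S─B with x∈p─q⁻ S B x∈S─B
    ... | x∈S , x∉B with covering x∈S
    ...   | zero  , x∈B  = ⊥-elim (x∉B x∈B)
    ...   | suc k , x∈Bₖ = k , x∈Bₖ

  module _ (nonempty : ∀ {B} → Block B → Nonempty B) where

    partitions-vanish : ∀ ℓ S → ∣ S ∣ < ℓ → partitions ℓ S ≡ 0ℤ
    partitions-vanish (suc ℓ) S ∣S∣<1+ℓ = trans (partitions-suc ℓ S) (∑-zero (allSubsets m) (λ {B} _ → vanish B))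
      where
      vanish : ∀ B → when (Block? B ×-dec B ⊆? S) (partitions ℓ (S ─ B)) ≡ 0ℤ
      vanish B = trans (when-cong (Block? B ×-dec B ⊆? S) smaller) (when-0 (Block? B ×-dec B ⊆? S))
        where
        smaller : Block B × B ⊆ S → partitions ℓ (S ─ B) ≡ 0ℤ
        smaller (block , B⊆S) with nonempty block
        ... | x , x∈B = partitions-vanish ℓ (S ─ B)
          (ℕP.<-≤-trans (p∩q≢∅⇒∣p─q∣<∣p∣ S B (x , x∈p∩q⁺ (B⊆S x∈B , x∈B))) (ℕP.≤-pred ∣S∣<1+ℓ))


-- Chains of α and χ on sets of letters

module _ {n : ℕ} (α : Permutation′ n) where

  position : Fin n → Fin n
  position x = α ⟨$⟩ˡ x

  _≺_ : Fin n → Fin n → Set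
  x ≺ y = x Fin.< y × position x Fin.< position y

  _≺?_ : ∀ x y → Dec (x ≺ y)
  x ≺? y = (x FinP.<? y) ×-dec (position x FinP.<? position y)

  ≺-trans : ∀ {x y z} → x ≺ y → y ≺ z → x ≺ z
  ≺-trans (x<y , px<py) (y<z , py<pz) = FinP.<-trans x<y y<z , FinP.<-trans px<py py<pz

  ≺-asym : ∀ {x y} → x ≺ y → ¬ (y ≺ x)
  ≺-asym (x<y , _) (y<x , _) = FinP.<-asym x<y y<x

  position-injective : ∀ {x y} → position x ≡ position y → x ≡ y
  position-injective eq = trans (sym (inverseʳ α)) (trans (cong (α ⟨$⟩ʳ_) eq) (inverseʳ α))

  α-injective : ∀ {i j} → α ⟨$⟩ʳ i ≡ α ⟨$⟩ʳ j → i ≡ j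
  α-injective eq = trans (sym (inverseˡ α)) (trans (cong (α ⟨$⟩ˡ_) eq) (inverseˡ α))

  Chain : Subset n → Set
  Chain = IncreasingOn α

  chain-ordered : ∀ {B y z} → Chain B → y ∈ B → z ∈ B → position y Fin.< position z → y ≺ z
  chain-ordered {B} chain y∈B z∈B py<pz = subst₂ Fin._<_ (inverseʳ α) (inverseʳ α)
    (chain _ _ py<pz (subst (_∈ B) (sym (inverseʳ α)) y∈B) (subst (_∈ B) (sym (inverseʳ α)) z∈B)) , py<pz

  Chain⇒≺-connected : ∀ {B y z} → Chain B → y ∈ B → z ∈ B → y ≢ z → y ≺ z ⊎ z ≺ y
  Chain⇒≺-connected {y = y} {z} chain y∈B z∈B y≢z with FinP.<-cmp (position y) (position z)
  ... | tri< py<pz _ _ = inj₁ (chain-ordered chain y∈B z∈B py<pz)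
  ... | tri≈ _ py≡pz _ = ⊥-elim (y≢z (position-injective py≡pz))
  ... | tri> _ _ pz<py = inj₂ (chain-ordered chain z∈B y∈B pz<py)

  ≺-connected⇒Chain : ∀ {B} → (∀ {y z} → y ∈ B → z ∈ B → y ≢ z → y ≺ z ⊎ z ≺ y) → Chain B
  ≺-connected⇒Chain connected i j i<j αi∈B αj∈B
    with connected αi∈B αj∈B (λ αi≡αj → FinP.<-irrefl (α-injective αi≡αj) i<j)
  ... | inj₁ (αi<αj , _) = αi<αj
  ... | inj₂ (_ , pαj<pαi) = ⊥-elim (FinP.<-asym i<j (subst₂ Fin._<_ (inverseˡ α) (inverseˡ α) pαj<pαi))

  NonemptyChain : Subset n → Set
  NonemptyChain B = Nonempty B × Chain B

  nonemptyChain? : Decidable NonemptyChain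
  nonemptyChain? B = nonempty? B ×-dec IncreasingOn? α B

  chainIn? : ∀ S B → Dec (NonemptyChain B × B ⊆ S)
  chainIn? S B = nonemptyChain? B ×-dec B ⊆? S

  chainPartitions : ℕ → Subset n → ℤ
  chainPartitions = partitions nonemptyChain?

  -- χ of the restriction of α to the letters in S.
  χ-on : Subset n → ℤ → ℤ
  χ-on S t = ∑[ ℓ ← upTo (suc n) ] (binomℤ t ℓ * chainPartitions ℓ S)

  χ-on-0 : ∀ S → χ-on S 0ℤ ≡ when (empty? S) 1ℤ
  χ-on-0 S = begin
    χ-on S 0ℤ
      ≡⟨ ∑-upTo-suc n (λ ℓ → binomℤ 0ℤ ℓ * chainPartitions ℓ S) ⟩
    binomℤ 0ℤ 0 * chainPartitions 0 S + ∑[ ℓ ← upTo n ] (binomℤ 0ℤ (suc ℓ) * chainPartitions (suc ℓ) S)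
      ≡⟨ cong₂ _+_ (trans (cong (_* chainPartitions 0 S) (binomℤ-zero 0ℤ)) (ℤP.*-identityˡ _)) (∑-zero (upTo n) vanish) ⟩
    chainPartitions 0 S + 0ℤ
      ≡⟨ trans (ℤP.+-identityʳ _) (partitions-zero nonemptyChain? S) ⟩
    when (empty? S) 1ℤ ∎
    where
    open ≡-Reasoning
    vanish : ∀ {ℓ} → ℓ ∈ₗ upTo n → binomℤ 0ℤ (suc ℓ) * chainPartitions (suc ℓ) S ≡ 0ℤ
    vanish {ℓ} _ = trans (cong (_* chainPartitions (suc ℓ) S) (binomℤ-0-suc ℓ)) (ℤP.*-zeroˡ (chainPartitions (suc ℓ) S))

  ∑-binomℤ-partitions-suc : ∀ t S →
    ∑[ ℓ ← upTo n ] (binomℤ t ℓ * chainPartitions (suc ℓ) S)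
    ≡ ∑[ B ← allSubsets n ] when (chainIn? S B) (χ-on (S ─ B) t)
  ∑-binomℤ-partitions-suc t S = begin
    ∑[ ℓ ← upTo n ] (bin ℓ * chainPartitions (suc ℓ) S)
      ≡⟨ ∑-cong (upTo n) (λ ℓ → trans (cong (bin ℓ *_) (partitions-suc nonemptyChain? ℓ S))
           (trans (sym (∑-*ˡ (allSubsets n) (bin ℓ) _))
                  (∑-cong (allSubsets n) (λ B → sym (when-*ˡ (chainIn? S B) (bin ℓ) _))))) ⟩
    ∑[ ℓ ← upTo n ] ∑[ B ← allSubsets n ] when (chainIn? S B) (bin ℓ * chainPartitions ℓ (S ─ B))
      ≡⟨ ∑-swap (upTo n) (allSubsets n) _ ⟩
    ∑[ B ← allSubsets n ] ∑[ ℓ ← upTo n ] when (chainIn? S B) (bin ℓ * chainPartitions ℓ (S ─ B))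
      ≡⟨ ∑-cong (allSubsets n) (λ B → trans (∑-when (upTo n) (chainIn? S B) _) (when-cong (chainIn? S B) drop-last)) ⟩
    ∑[ B ← allSubsets n ] when (chainIn? S B) (χ-on (S ─ B) t) ∎
    where
    open ≡-Reasoning
    bin : ℕ → ℤ
    bin = binomℤ t
    drop-last : ∀ {B} → NonemptyChain B × B ⊆ S → ∑[ ℓ ← upTo n ] (bin ℓ * chainPartitions ℓ (S ─ B)) ≡ χ-on (S ─ B) t
    drop-last {B} (((x , x∈B) , _) , B⊆S) = sym (begin
      χ-on (S ─ B) t              ≡⟨ ∑-upTo-last n _ ⟩
      rest + bin n * chainPartitions n (S ─ B)
        ≡⟨ cong (λ z → rest + bin n * z) (partitions-vanish nonemptyChain? proj₁ n (S ─ B) ∣S─B∣<n) ⟩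
      rest + bin n * 0ℤ           ≡⟨ cong (_+_ rest) (ℤP.*-zeroʳ (bin n)) ⟩
      rest + 0ℤ                   ≡⟨ ℤP.+-identityʳ rest ⟩
      rest                        ∎)
      where
      rest : ℤ
      rest = ∑[ ℓ ← upTo n ] (bin ℓ * chainPartitions ℓ (S ─ B))
      ∣S─B∣<n : ∣ S ─ B ∣ < n
      ∣S─B∣<n = ℕP.<-≤-trans (p∩q≢∅⇒∣p─q∣<∣p∣ S B (x , x∈p∩q⁺ (B⊆S x∈B , x∈B))) (∣p∣≤n S)

  χ-on-1+ : ∀ {t} → FallingDivisible t → ∀ S →
            χ-on S (1ℤ + t) ≡ χ-on S t + ∑[ B ← allSubsets n ] when (chainIn? S B) (χ-on (S ─ B) t)
  χ-on-1+ {t} div S = begin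
    χ-on S (1ℤ + t)
      ≡⟨ ∑-upTo-suc n (λ ℓ → binomℤ (1ℤ + t) ℓ * C ℓ) ⟩
    binomℤ (1ℤ + t) 0 * C 0 + ∑[ ℓ ← upTo n ] (binomℤ (1ℤ + t) (suc ℓ) * C (suc ℓ))
      ≡⟨ cong₂ _+_ (cong (_* C 0) (trans (binomℤ-zero (1ℤ + t)) (sym (binomℤ-zero t)))) (∑-cong (upTo n) pascal) ⟩
    binomℤ t 0 * C 0 + ∑[ ℓ ← upTo n ] (binomℤ t (suc ℓ) * C (suc ℓ) + binomℤ t ℓ * C (suc ℓ))
      ≡⟨ cong (_+_ (binomℤ t 0 * C 0)) (∑-+ (upTo n) _ _) ⟩
    binomℤ t 0 * C 0 + (∑[ ℓ ← upTo n ] (binomℤ t (suc ℓ) * C (suc ℓ)) + shifted)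
      ≡⟨ ℤP.+-assoc (binomℤ t 0 * C 0) _ shifted ⟨
    (binomℤ t 0 * C 0 + ∑[ ℓ ← upTo n ] (binomℤ t (suc ℓ) * C (suc ℓ))) + shifted
      ≡⟨ cong₂ _+_ (sym (∑-upTo-suc n (λ ℓ → binomℤ t ℓ * C ℓ))) (∑-binomℤ-partitions-suc t S) ⟩
    χ-on S t + ∑[ B ← allSubsets n ] when (chainIn? S B) (χ-on (S ─ B) t) ∎
    where
    open ≡-Reasoning
    C : ℕ → ℤ
    C ℓ = chainPartitions ℓ S
    shifted : ℤ
    shifted = ∑[ ℓ ← upTo n ] (binomℤ t ℓ * C (suc ℓ))
    pascal : ∀ ℓ → binomℤ (1ℤ + t) (suc ℓ) * C (suc ℓ) ≡ binomℤ t (suc ℓ) * C (suc ℓ) + binomℤ t ℓ * C (suc ℓ)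
    pascal ℓ = trans (cong (_* C (suc ℓ)) (binomℤ-pascal div ℓ))
                     (ℤP.*-distribʳ-+ (C (suc ℓ)) (binomℤ t (suc ℓ)) (binomℤ t ℓ))

  weakChainPartitions : ℕ → Subset n → ℤ
  weakChainPartitions = partitions (IncreasingOn? α)

  ∑-chains-split : ∀ S (f : Subset n → ℤ) →
    ∑[ B ← allSubsets n ] when (IncreasingOn? α B ×-dec B ⊆? S) (f B)
    ≡ f ⊥ + ∑[ B ← allSubsets n ] when (chainIn? S B) (f B)
  ∑-chains-split S f = trans (∑-split-⊥ (λ B → IncreasingOn? α B ×-dec B ⊆? S) (⊥-chain , ⊥⊆) f)
    (cong (_+_ (f ⊥)) (∑-cong (allSubsets n) (λ B →
      when-⇔ (nonempty? B ×-dec (IncreasingOn? α B ×-dec B ⊆? S)) (chainIn? S B)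
             (λ (ne , ch , sub) → (ne , ch) , sub) (λ ((ne , ch) , sub) → ne , ch , sub) (f B))))
    where
    ⊥-chain : Chain ⊥
    ⊥-chain _ _ _ αi∈⊥ _ = ⊥-elim (∉⊥ αi∈⊥)

  χ-on-ℕ : ∀ t S → χ-on S (+ t) ≡ weakChainPartitions t S
  χ-on-ℕ zero    S = trans (χ-on-0 S) (sym (partitions-zero (IncreasingOn? α) S))
  χ-on-ℕ (suc t) S = begin
    χ-on S (+ suc t)
      ≡⟨ χ-on-1+ (fallingDivisible-ℕ t) S ⟩
    χ-on S (+ t) + rest
      ≡⟨ cong (λ S′ → χ-on S′ (+ t) + rest) (p─⊥≡p S) ⟨
    χ-on (S ─ ⊥) (+ t) + rest
      ≡⟨ ∑-chains-split S (λ B → χ-on (S ─ B) (+ t)) ⟨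
    ∑[ B ← allSubsets n ] when (IncreasingOn? α B ×-dec B ⊆? S) (χ-on (S ─ B) (+ t))
      ≡⟨ ∑-cong (allSubsets n) (λ B → cong (when (IncreasingOn? α B ×-dec B ⊆? S)) (χ-on-ℕ t (S ─ B))) ⟩
    ∑[ B ← allSubsets n ] when (IncreasingOn? α B ×-dec B ⊆? S) (weakChainPartitions t (S ─ B))
      ≡⟨ partitions-suc (IncreasingOn? α) t S ⟨
    weakChainPartitions (suc t) S ∎
    where
    open ≡-Reasoning
    rest : ℤ
    rest = ∑[ B ← allSubsets n ] when (chainIn? S B) (χ-on (S ─ B) (+ t))

  χ-on-−1 : ∀ S → χ-on S (- 1ℤ) ≡ when (empty? S) 1ℤ - ∑[ B ← allSubsets n ] when (chainIn? S B) (χ-on (S ─ B) (- 1ℤ))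
  χ-on-−1 S = a≡b+c⇒b≡a-c (trans (sym (χ-on-0 S)) (χ-on-1+ fallingDivisible-−1 S))
    where
    a≡b+c⇒b≡a-c : ∀ {a b c} → a ≡ b + c → b ≡ a - c
    a≡b+c⇒b≡a-c {b = b} {c} refl = cancel b c
      where
      cancel : ∀ b c → b ≡ b + c - c
      cancel = solve-∀

  -- The value at −1

  σ : Subset n → ℤ
  σ S = χ-on S (- 1ℤ)

  LeastIn : Fin n → Subset n → Set
  LeastIn x B = x ∈ B × (∀ {y} → y ∈ B → y ≢ x → x ≺ y)

  leastIn? : ∀ x B → Dec (LeastIn x B)
  leastIn? x B = (x ∈? B) ×-dec Dec.map′ (λ h {y} → h y) (λ h y → h {y})
    (FinP.all? λ y → (y ∈? B) →-dec (¬? (y FinP.≟ x) →-dec (x ≺? y)))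

  leastIn-unique : ∀ {x y B} → LeastIn x B → LeastIn y B → x ≡ y
  leastIn-unique {x} {y} (x∈B , x≺) (y∈B , y≺) with x FinP.≟ y
  ... | yes x≡y = x≡y
  ... | no  x≢y = ⊥-elim (≺-asym (x≺ y∈B (x≢y ∘ sym)) (y≺ x∈B x≢y))

  chain-leastIn : ∀ {B} → Chain B → Nonempty B → ∃ λ x → LeastIn x B
  chain-leastIn {B} chain nonempty with minimum B nonempty
  ... | x , x∈B , x≤ = x , x∈B , x≺
    where
    x≺ : ∀ {y} → y ∈ B → y ≢ x → x ≺ y
    x≺ y∈B y≢x with Chain⇒≺-connected chain y∈B x∈B y≢x
    ... | inj₁ (y<x , _) = ⊥-elim (ℕP.<⇒≱ y<x (x≤ y∈B))
    ... | inj₂ x≺y       = x≺y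

  ChainFrom : Fin n → Subset n → Subset n → Set
  ChainFrom x S B = LeastIn x B × Chain B × B ⊆ S

  chainFrom? : ∀ x S B → Dec (ChainFrom x S B)
  chainFrom? x S B = leastIn? x B ×-dec IncreasingOn? α B ×-dec B ⊆? S

  -- The terms of the recursion χ-on-−1 whose chain has ≺-least element x.
  σ-from : Fin n → Subset n → ℤ
  σ-from x S = ∑[ B ← allSubsets n ] when (chainFrom? x S B) (σ (S ─ B))

  ∑-chainIn-by-least : ∀ S (g : Subset n → ℤ) →
    ∑[ B ← allSubsets n ] when (chainIn? S B) (g B)
    ≡ ∑[ x ← allFin n ] ∑[ B ← allSubsets n ] when (chainFrom? x S B) (g B)
  ∑-chainIn-by-least S = ∑-fibres (allSubsets n) (allFin n) (Unique.allFin⁺ n) ∈-allFin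
    (chainIn? S) (λ x → chainFrom? x S)
    (λ ((nonempty , chain) , B⊆S) → let x , least = chain-leastIn chain nonempty in
      x , (least , chain , B⊆S) , λ (least′ , _) → leastIn-unique least′ least)
    (λ ((x∈B , _) , chain , B⊆S) → ((_ , x∈B) , chain) , B⊆S)

  σ-rec : ∀ S → σ S ≡ when (empty? S) 1ℤ - ∑[ x ← allFin n ] σ-from x S
  σ-rec S = trans (χ-on-−1 S) (cong (_-_ (when (empty? S) 1ℤ)) (∑-chainIn-by-least S (λ B → σ (S ─ B))))

  σ-from-∉ : ∀ {x S} → x ∉ S → σ-from x S ≡ 0ℤ
  σ-from-∉ {x} {S} x∉S = ∑-zero (allSubsets n) λ {B} _ →
    when-no (chainFrom? x S B) (λ ((x∈B , _) , _ , B⊆S) → x∉S (B⊆S x∈B)) (σ (S ─ B))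

  Above : Fin n → Subset n → Set
  Above x B = ∀ {y} → y ∈ B → x ≺ y

  above? : ∀ x B → Dec (Above x B)
  above? x B = Dec.map′ (λ h {y} → h y) (λ h y → h {y}) (FinP.all? λ y → (y ∈? B) →-dec (x ≺? y))

  ChainAbove : Fin n → Subset n → Subset n → Set
  ChainAbove x S B = Chain B × B ⊆ S ∖ x × Above x B

  chainAbove? : ∀ x S B → Dec (ChainAbove x S B)
  chainAbove? x S B = IncreasingOn? α B ×-dec B ⊆? S ∖ x ×-dec above? x B

  chainFrom-insert⇒chainAbove : ∀ {x S B} → x ∉ B → ChainFrom x S (insert x B) → ChainAbove x S B
  chainFrom-insert⇒chainAbove {x} {S} {B} x∉B ((_ , x≺) , chain , B⊆S) =
    (λ i j i<j αi∈B αj∈B → chain i j i<j (∈-insert⁺ B αi∈B) (∈-insert⁺ B αj∈B)) ,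
    (λ y∈B → x∈p∧x≢y⇒x∈p-y (B⊆S (∈-insert⁺ B y∈B)) (y≢x y∈B)) ,
    (λ y∈B → x≺ (∈-insert⁺ B y∈B) (y≢x y∈B))
    where
    y≢x : ∀ {y} → y ∈ B → y ≢ x
    y≢x y∈B refl = x∉B y∈B

  chainAbove⇒chainFrom-insert : ∀ {x S B} → x ∈ S → ChainAbove x S B → ChainFrom x S (insert x B)
  chainAbove⇒chainFrom-insert {x} {S} {B} x∈S (chain , B⊆S-x , above) =
    (x∈insert x B , λ y∈ y≢x → above (∈-insert⁻ B y∈ y≢x)) , ≺-connected⇒Chain connected , insert⊆S
    where
    connected : ∀ {y z} → y ∈ insert x B → z ∈ insert x B → y ≢ z → y ≺ z ⊎ z ≺ y
    connected {y} {z} y∈ z∈ y≢z with y FinP.≟ x | z FinP.≟ x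
    ... | yes refl | yes refl = ⊥-elim (y≢z refl)
    ... | yes refl | no  z≢x  = inj₁ (above (∈-insert⁻ B z∈ z≢x))
    ... | no  y≢x  | yes refl = inj₂ (above (∈-insert⁻ B y∈ y≢x))
    ... | no  y≢x  | no  z≢x  = Chain⇒≺-connected chain (∈-insert⁻ B y∈ y≢x) (∈-insert⁻ B z∈ z≢x) y≢z
    insert⊆S : insert x B ⊆ S
    insert⊆S {y} y∈ with y FinP.≟ x
    ... | yes refl = x∈S
    ... | no  y≢x  = proj₁ (x∈p-y⁻ S (B⊆S-x (∈-insert⁻ B y∈ y≢x)))

  σ-from-remove-least : ∀ {x S} → x ∈ S →
    σ-from x S ≡ ∑[ B ← allSubsets n ] when (chainAbove? x S B) (σ (S ∖ x ─ B))
  σ-from-remove-least {x} {S} x∈S =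
    trans (∑-split-at x (λ B → when (chainFrom? x S B) (σ (S ─ B)))) (∑-cong (allSubsets n) (λ B → pointwise B (x ∈? B)))
    where
    pointwise : ∀ B (x∈?B : Dec (x ∈ B)) →
      when (¬? x∈?B) (when (chainFrom? x S B) (σ (S ─ B)) + when (chainFrom? x S (insert x B)) (σ (S ─ insert x B)))
      ≡ when (chainAbove? x S B) (σ (S ∖ x ─ B))
    pointwise B (yes x∈B) = sym (when-no (chainAbove? x S B) (λ (_ , B⊆S-x , _) → proj₂ (x∈p-y⁻ S (B⊆S-x x∈B)) refl) _)
    pointwise B (no x∉B) = begin
      when (chainFrom? x S B) (σ (S ─ B)) + when (chainFrom? x S (insert x B)) (σ (S ─ insert x B))
        ≡⟨ cong (_+ when (chainFrom? x S (insert x B)) (σ (S ─ insert x B)))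
                (when-no (chainFrom? x S B) (λ ((x∈B , _) , _) → x∉B x∈B) _) ⟩
      0ℤ + when (chainFrom? x S (insert x B)) (σ (S ─ insert x B))
        ≡⟨ ℤP.+-identityˡ _ ⟩
      when (chainFrom? x S (insert x B)) (σ (S ─ insert x B))
        ≡⟨ when-⇔ (chainFrom? x S (insert x B)) (chainAbove? x S B)
                  (chainFrom-insert⇒chainAbove x∉B) (chainAbove⇒chainFrom-insert x∈S) _ ⟩
      when (chainAbove? x S B) (σ (S ─ insert x B))
        ≡⟨ cong (when (chainAbove? x S B) ∘ σ) (p─insert≡p-x─q S B x) ⟩
      when (chainAbove? x S B) (σ (S ∖ x ─ B)) ∎
      where open ≡-Reasoning

  ∑-chainAbove : ∀ x S → ∑[ B ← allSubsets n ] when (chainAbove? x S B) (σ (S ∖ x ─ B))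
                       ≡ σ (S ∖ x) + ∑[ y ← allFin n ] when (x ≺? y) (σ-from y (S ∖ x))
  ∑-chainAbove x S = begin
    ∑[ B ← allSubsets n ] when (chainAbove? x S B) (σ (S′ ─ B))
      ≡⟨ ∑-split-⊥ (chainAbove? x S) ((λ _ _ _ αi∈⊥ _ → ⊥-elim (∉⊥ αi∈⊥)) , ⊥⊆ , λ y∈⊥ → ⊥-elim (∉⊥ y∈⊥)) (σ ∘ (S′ ─_)) ⟩
    σ (S′ ─ ⊥) + ∑[ B ← allSubsets n ] when (nonempty? B ×-dec chainAbove? x S B) (σ (S′ ─ B))
      ≡⟨ cong₂ _+_ (cong σ (p─⊥≡p S′)) (∑-fibres (allSubsets n) (allFin n) (Unique.allFin⁺ n) ∈-allFin
                     (λ B → nonempty? B ×-dec chainAbove? x S B) (λ y B → x ≺? y ×-dec chainFrom? y S′ B)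
                     fibre fibre⇒nonempty-chainAbove (σ ∘ (S′ ─_))) ⟩
    σ S′ + ∑[ y ← allFin n ] ∑[ B ← allSubsets n ] when (x ≺? y ×-dec chainFrom? y S′ B) (σ (S′ ─ B))
      ≡⟨ cong (_+_ (σ S′)) (∑-cong (allFin n) (λ y →
           trans (∑-cong (allSubsets n) (λ B → when-× (x ≺? y) (chainFrom? y S′ B) _))
                 (∑-when (allSubsets n) (x ≺? y) _))) ⟩
    σ S′ + ∑[ y ← allFin n ] when (x ≺? y) (σ-from y S′) ∎
    where
    open ≡-Reasoning
    S′ : Subset n
    S′ = S ∖ x
    fibre : ∀ {B} → Nonempty B × ChainAbove x S B →
            ∃ λ y → (x ≺ y × ChainFrom y S′ B) × (∀ {y′} → x ≺ y′ × ChainFrom y′ S′ B → y′ ≡ y)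
    fibre (nonempty , chain , B⊆S′ , above) with chain-leastIn chain nonempty
    ... | y , least@(y∈B , _) = y , (above y∈B , least , chain , B⊆S′) , λ (_ , least′ , _) → leastIn-unique least′ least
    fibre⇒nonempty-chainAbove : ∀ {y B} → x ≺ y × ChainFrom y S′ B → Nonempty B × ChainAbove x S B
    fibre⇒nonempty-chainAbove {y} {B} (x≺y , (y∈B , y≺) , chain , B⊆S′) = (y , y∈B) , chain , B⊆S′ , above
      where
      above : Above x B
      above {z} z∈B with z FinP.≟ y
      ... | yes refl = x≺y
      ... | no  z≢y  = ≺-trans x≺y (y≺ z∈B z≢y)

  -- For y ≢ x, CanFollow (just x) y is ¬ (x ≺ y), in the form used by DescCond.
  CanFollow : Maybe (Fin n) → Fin n → Set
  CanFollow nothing  y = Unit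
  CanFollow (just x) y = y Fin.< x ⊎ position y Fin.< position x

  canFollow? : ∀ prev y → Dec (CanFollow prev y)
  canFollow? nothing  y = yes tt
  canFollow? (just x) y = (y FinP.<? x) Dec.⊎-dec (position y FinP.<? position x)

  ≺⊎canFollow : ∀ {x y} → y ≢ x → x ≺ y ⊎ CanFollow (just x) y
  ≺⊎canFollow {x} {y} y≢x with FinP.<-cmp y x
  ... | tri< y<x _ _ = inj₂ (inj₁ y<x)
  ... | tri≈ _ y≡x _ = ⊥-elim (y≢x y≡x)
  ... | tri> _ _ x<y with FinP.<-cmp (position y) (position x)
  ...   | tri< py<px _ _ = inj₂ (inj₂ py<px)
  ...   | tri≈ _ py≡px _ = ⊥-elim (y≢x (position-injective py≡px))
  ...   | tri> _ _ px<py = inj₁ (x<y , px<py)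

  canFollow⇒⊀ : ∀ {x y} → CanFollow (just x) y → ¬ (x ≺ y)
  canFollow⇒⊀ (inj₁ y<x)   (x<y , _)   = FinP.<-asym y<x x<y
  canFollow⇒⊀ (inj₂ py<px) (_ , px<py) = FinP.<-asym py<px px<py

  σ-from-rec : ∀ {x S} → x ∈ S →
    σ-from x S ≡ when (empty? (S ∖ x)) 1ℤ - ∑[ y ← allFin n ] when (canFollow? (just x) y) (σ-from y (S ∖ x))
  σ-from-rec {x} {S} x∈S = begin
    σ-from x S                                             ≡⟨ trans (σ-from-remove-least x∈S) (∑-chainAbove x S) ⟩
    σ S′ + above                                           ≡⟨ cong (_+ above) (σ-rec S′) ⟩
    (when (empty? S′) 1ℤ - ∑[ y ← allFin n ] σ-from y S′) + above
      ≡⟨ cong (λ z → (when (empty? S′) 1ℤ - z) + above) (trans (∑-cong (allFin n) split) (∑-+ (allFin n) _ _)) ⟩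
    (when (empty? S′) 1ℤ - (above + following)) + above  ≡⟨ cancel (when (empty? S′) 1ℤ) above following ⟩
    when (empty? S′) 1ℤ - following                        ∎
    where
    open ≡-Reasoning
    S′ : Subset n
    S′ = S ∖ x
    above following : ℤ
    above     = ∑[ y ← allFin n ] when (x ≺? y) (σ-from y S′)
    following = ∑[ y ← allFin n ] when (canFollow? (just x) y) (σ-from y S′)
    split : ∀ y → σ-from y S′ ≡ when (x ≺? y) (σ-from y S′) + when (canFollow? (just x) y) (σ-from y S′)
    split y with y FinP.≟ x
    ... | yes refl = begin
      σ-from x S′                 ≡⟨ σ-from-∉ (λ x∈S′ → proj₂ (x∈p-y⁻ S x∈S′) refl) ⟩
      0ℤ                          ≡⟨ cong₂ _+_ (when-0 (x ≺? x)) (when-0 (canFollow? (just x) x)) ⟨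
      when (x ≺? x) 0ℤ + when (canFollow? (just x) x) 0ℤ
        ≡⟨ cong (λ z → when (x ≺? x) z + when (canFollow? (just x) x) z) (σ-from-∉ (λ x∈S′ → proj₂ (x∈p-y⁻ S x∈S′) refl)) ⟨
      when (x ≺? x) (σ-from x S′) + when (canFollow? (just x) x) (σ-from x S′) ∎
    ... | no y≢x = trans (when-¬ (x ≺? y) (σ-from y S′)) (cong (_+_ (when (x ≺? y) (σ-from y S′)))
      (when-⇔ (¬? (x ≺? y)) (canFollow? (just x) y)
              (λ x⊀y → fromInj₂ (⊥-elim ∘ x⊀y) (≺⊎canFollow y≢x)) canFollow⇒⊀ (σ-from y S′)))
    cancel : ∀ a b c → (a - (b + c)) + b ≡ a - c
    cancel = solve-∀

  NoAscentWord : ∀ {k} → Maybe (Fin n) → Subset n → Vec (Fin n) k → Set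
  NoAscentWord prev S []      = Unit
  NoAscentWord prev S (y ∷ w) = (y ∈ S × CanFollow prev y) × NoAscentWord (just y) (S ∖ y) w

  noAscentWord? : ∀ {k} prev S (w : Vec (Fin n) k) → Dec (NoAscentWord prev S w)
  noAscentWord? prev S []      = yes tt
  noAscentWord? prev S (y ∷ w) = ((y ∈? S) ×-dec canFollow? prev y) ×-dec noAscentWord? (just y) (S ∖ y) w

  noAscentWords : ℕ → Maybe (Fin n) → Subset n → ℤ
  noAscentWords k prev S = ∑[ w ← allVecs (allFin n) k ] when (noAscentWord? prev S w) 1ℤ

  noAscentWords-suc : ∀ k prev S → noAscentWords (suc k) prev S ≡
    ∑[ y ← allFin n ] when ((y ∈? S) ×-dec canFollow? prev y) (noAscentWords k (just y) (S ∖ y))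
  noAscentWords-suc k prev S = trans (∑-concatMap (allFin n) (λ y → List.map (y ∷_) ws) _)
    (∑-cong (allFin n) λ y → trans (∑-map ws (y ∷_) _)
      (trans (∑-cong ws (λ w → when-× ((y ∈? S) ×-dec canFollow? prev y) (noAscentWord? (just y) (S ∖ y) w) 1ℤ))
             (∑-when ws ((y ∈? S) ×-dec canFollow? prev y) _)))
    where
    ws : List (Vec (Fin n) k)
    ws = allVecs (allFin n) k

  mutual
    σ-from≡ : ∀ k {x S} → x ∈ S → ∣ S ∖ x ∣ ≡ k → σ-from x S ≡ (- 1ℤ) ^ k * noAscentWords k (just x) (S ∖ x)
    σ-from≡ k x∈S ∣S-x∣≡k = trans (σ-from-rec x∈S) (alternating k (just _) _ ∣S-x∣≡k)

    alternating : ∀ k prev S → ∣ S ∣ ≡ k →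
      when (empty? S) 1ℤ - ∑[ y ← allFin n ] when (canFollow? prev y) (σ-from y S) ≡ (- 1ℤ) ^ k * noAscentWords k prev S
    alternating zero prev S ∣S∣≡0 = cong₂ _-_ (when-yes (empty? S) empty 1ℤ)
      (∑-zero (allFin n) (λ {y} _ → trans (cong (when (canFollow? prev y)) (σ-from-∉ (λ y∈S → empty (y , y∈S))))
                                          (when-0 (canFollow? prev y))))
      where
      empty : Empty S
      empty = ∣p∣≡0⇒Empty ∣S∣≡0
    alternating (suc k) prev S ∣S∣≡1+k = begin
      when (empty? S) 1ℤ - ∑[ y ← allFin n ] when (canFollow? prev y) (σ-from y S)
        ≡⟨ cong₂ _-_ (when-no (empty? S) (λ empty → ℕP.0≢1+n (trans (sym (Empty⇒∣p∣≡0 empty)) ∣S∣≡1+k)) 1ℤ)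
                     (trans (∑-cong (allFin n) term) (∑-*ˡ (allFin n) ((- 1ℤ) ^ k) _)) ⟩
      0ℤ - (- 1ℤ) ^ k * ∑[ y ← allFin n ] when ((y ∈? S) ×-dec canFollow? prev y) (noAscentWords k (just y) (S ∖ y))
        ≡⟨ negate ((- 1ℤ) ^ k) _ ⟩
      (- 1ℤ) ^ suc k * ∑[ y ← allFin n ] when ((y ∈? S) ×-dec canFollow? prev y) (noAscentWords k (just y) (S ∖ y))
        ≡⟨ cong ((- 1ℤ) ^ suc k *_) (noAscentWords-suc k prev S) ⟨
      (- 1ℤ) ^ suc k * noAscentWords (suc k) prev S ∎
      where
      open ≡-Reasoning
      negate : ∀ s w → 0ℤ - s * w ≡ (- 1ℤ * s) * w
      negate = solve-∀
      term : ∀ y → when (canFollow? prev y) (σ-from y S)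
                   ≡ (- 1ℤ) ^ k * when ((y ∈? S) ×-dec canFollow? prev y) (noAscentWords k (just y) (S ∖ y))
      term y with y ∈? S
      ... | no  y∉S = trans (cong (when (canFollow? prev y)) (σ-from-∉ y∉S))
                            (trans (when-0 (canFollow? prev y)) (sym (ℤP.*-zeroʳ ((- 1ℤ) ^ k))))
      ... | yes y∈S = trans (cong (when (canFollow? prev y)) (σ-from≡ k y∈S (∣p∣≡1+k⇒∣p-x∣≡k y∈S ∣S∣≡1+k)))
                            (when-*ˡ (canFollow? prev y) ((- 1ℤ) ^ k) _)

  σ≡ : ∀ {k S} → ∣ S ∣ ≡ k → σ S ≡ (- 1ℤ) ^ k * noAscentWords k nothing S
  σ≡ {k} {S} ∣S∣≡k = trans (σ-rec S) (alternating k nothing S ∣S∣≡k)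

  Distinct : ∀ {k} → Vec (Fin n) k → Set
  Distinct {k} w = ∀ (i j : Fin k) → lookup w i ≡ lookup w j → i ≡ j

  NoAscents : ∀ {k} → Vec (Fin n) k → Set
  NoAscents {k} w = ∀ (i j : Fin k) → toℕ j ≡ suc (toℕ i) → CanFollow (just (lookup w i)) (lookup w j)

  HeadCanFollow : ∀ {k} → Maybe (Fin n) → Vec (Fin n) k → Set
  HeadCanFollow prev []      = Unit
  HeadCanFollow prev (y ∷ _) = CanFollow prev y

  noAscentWord⇒ : ∀ {k} prev S (w : Vec (Fin n) k) → NoAscentWord prev S w →
                  (∀ i → lookup w i ∈ S) × Distinct w × NoAscents w × HeadCanFollow prev w
  noAscentWord⇒ prev S []      _ = (λ ()) , (λ ()) , (λ ()) , tt
  noAscentWord⇒ prev S (y ∷ w) ((y∈S , follows) , rest) with noAscentWord⇒ (just y) (S ∖ y) w rest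
  ... | ∈S-y , distinct , noAscents , headFollows = ∈S , distinct′ , noAscents′ , follows
    where
    ∈S : ∀ i → lookup (y ∷ w) i ∈ S
    ∈S zero    = y∈S
    ∈S (suc i) = proj₁ (x∈p-y⁻ S (∈S-y i))
    ≢y : ∀ i → lookup w i ≢ y
    ≢y i = proj₂ (x∈p-y⁻ S (∈S-y i))
    distinct′ : Distinct (y ∷ w)
    distinct′ zero    zero    _  = refl
    distinct′ zero    (suc j) eq = ⊥-elim (≢y j (sym eq))
    distinct′ (suc i) zero    eq = ⊥-elim (≢y i eq)
    distinct′ (suc i) (suc j) eq = cong suc (distinct i j eq)
    noAscents′ : NoAscents (y ∷ w)
    noAscents′ zero    (suc zero)    _  = head w headFollows
      where
      head : ∀ {k} (v : Vec (Fin n) (suc k)) → HeadCanFollow (just y) v → CanFollow (just y) (lookup v zero)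
      head (_ ∷ _) follows′ = follows′
    noAscents′ zero    (suc (suc j)) ()
    noAscents′ (suc i) zero          ()
    noAscents′ (suc i) (suc j)       eq = noAscents i j (ℕP.suc-injective eq)

  noAscentWord⇐ : ∀ {k} prev S (w : Vec (Fin n) k) → (∀ i → lookup w i ∈ S) → Distinct w → NoAscents w →
                  HeadCanFollow prev w → NoAscentWord prev S w
  noAscentWord⇐ prev S []      _  _        _         _       = tt
  noAscentWord⇐ prev S (y ∷ w) ∈S distinct noAscents follows =
    (∈S zero , follows) ,
    noAscentWord⇐ (just y) (S ∖ y) w
      (λ i → x∈p∧x≢y⇒x∈p-y (∈S (suc i)) (λ eq → FinP.0≢1+n (sym (distinct (suc i) zero eq))))
      (λ i j eq → FinP.suc-injective (distinct (suc i) (suc j) eq))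
      (λ i j eq → noAscents (suc i) (suc j) (cong suc eq))
      (headFollows w noAscents)
    where
    headFollows : ∀ {k} (v : Vec (Fin n) k) → NoAscents (y ∷ v) → HeadCanFollow (just y) v
    headFollows []      _          = tt
    headFollows (_ ∷ _) noAscents′ = noAscents′ zero (suc zero) refl

  noAscentWords≡d : noAscentWords n nothing ⊤ ≡ + d α
  noAscentWords≡d = trans
    (∑-cong (allVecs (allFin n) n) (λ w → when-⇔ (noAscentWord? nothing ⊤ w) (DCond? α w)
      (λ word → let _ , distinct , noAscents , _ = noAscentWord⇒ nothing ⊤ w word in distinct , noAscents)
      (λ (distinct , noAscents) → noAscentWord⇐ nothing ⊤ w (λ _ → ∈⊤) distinct noAscents (head-nothing w)) 1ℤ))
    (∑-count (allVecs (allFin n) n) (DCond? α))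
    where
    head-nothing : ∀ {k} (w : Vec (Fin n) k) → HeadCanFollow nothing w
    head-nothing []      = tt
    head-nothing (_ ∷ _) = tt

  -- Set compositions and colourings

  sizes : ∀ {ℓ} → Vec (Subset n) ℓ → Vec ℕ ℓ
  sizes = Vec.map ∣_∣

  compositions⁺ : ∀ ℓ → Unique (compositions n ℓ)
  compositions⁺ ℓ = Unique.filter⁺ (IsComposition? n)
    (Unique.map⁺ (λ {u} {v} eq → lookup-ext (λ i → FinP.toℕ-injective (begin
        toℕ (lookup u i)              ≡⟨ Vec.lookup-map i toℕ u ⟨
        lookup (Vec.map toℕ u) i      ≡⟨ cong (λ w → lookup w i) eq ⟩
        lookup (Vec.map toℕ v) i      ≡⟨ Vec.lookup-map i toℕ v ⟩
        toℕ (lookup v i)              ∎)))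
      (allVecs⁺ (allFin (suc n)) (Unique.allFin⁺ (suc n)) ℓ))
    where open ≡-Reasoning

  sizes∈compositions : ∀ {ℓ} (Bs : Vec (Subset n) ℓ) → OrderedPartition nonemptyChain? ⊤ Bs →
                       sizes Bs ∈ₗ compositions n ℓ
  sizes∈compositions {ℓ} Bs partition = ∈-filter⁺ (IsComposition? n) (subst (_∈ₗ _) sizes≡ sizes∈) isComposition
    where
    open IsPartition (orderedPartition⇒isPartition nonemptyChain? ⊤ Bs partition)
    sizes< : Vec (Fin (suc n)) ℓ
    sizes< = Vec.map (λ B → Fin.fromℕ< (s≤s (∣p∣≤n B))) Bs
    sizes≡ : Vec.map toℕ sizes< ≡ sizes Bs
    sizes≡ = trans (sym (Vec.map-∘ toℕ _ Bs)) (Vec.map-cong (λ B → FinP.toℕ-fromℕ< (s≤s (∣p∣≤n B))) Bs)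
    sizes∈ : Vec.map toℕ sizes< ∈ₗ List.map (Vec.map toℕ) (allVecs (allFin (suc n)) ℓ)
    sizes∈ = ∈-map⁺ (Vec.map toℕ) (∈-allVecs (allFin (suc n)) sizes< (λ _ → ∈-allFin _))
    isComposition : IsComposition n (sizes Bs)
    isComposition = (λ k → subst (1 ≤_) (sym (Vec.lookup-map k ∣_∣ Bs)) (x∈p⇒∣p∣>0 (proj₂ (proj₁ (blocks k)))))
                  , trans (sum-sizes nonemptyChain? ⊤ Bs partition) (∣⊤∣≡n n)

  incrSetComp⇒orderedPartition : ∀ {ℓ} {a : Vec ℕ ℓ} {Bs} → a ∈ₗ compositions n ℓ →
    IncrSetCompOfType α a Bs → OrderedPartition nonemptyChain? ⊤ Bs
  incrSetComp⇒orderedPartition {ℓ} {a} {Bs} a∈ (disjoint , covers , ∣Bₖ∣≡aₖ , increasing) =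
    isPartition⇒orderedPartition nonemptyChain? ⊤ Bs record
      { disjoint = disjoint
      ; covering = λ {x} _ → covers x
      ; within   = λ _ _ → ∈⊤
      ; blocks   = λ k → ∣p∣>0⇒Nonempty (subst (0 <_) (sym (∣Bₖ∣≡aₖ k)) (aₖ>0 k)) , increasing k
      }
    where
    aₖ>0 : ∀ k → 0 < lookup a k
    aₖ>0 = proj₁ (proj₂ (∈-filter⁻ (IsComposition? n) {xs = List.map (Vec.map toℕ) (allVecs (allFin (suc n)) ℓ)} a∈))

  incrSetComp⇒sizes : ∀ {ℓ} {a : Vec ℕ ℓ} {Bs} → IncrSetCompOfType α a Bs → a ≡ sizes Bs
  incrSetComp⇒sizes {Bs = Bs} (_ , _ , ∣Bₖ∣≡aₖ , _) =
    lookup-ext (λ k → trans (sym (∣Bₖ∣≡aₖ k)) (sym (Vec.lookup-map k ∣_∣ Bs)))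

  orderedPartition⇒incrSetComp : ∀ {ℓ} (Bs : Vec (Subset n) ℓ) → OrderedPartition nonemptyChain? ⊤ Bs →
                                  IncrSetCompOfType α (sizes Bs) Bs
  orderedPartition⇒incrSetComp Bs partition =
    disjoint , (λ x → covering (∈⊤ {x = x})) , (λ k → sym (Vec.lookup-map k ∣_∣ Bs)) , (λ k → proj₂ (blocks k))
    where open IsPartition (orderedPartition⇒isPartition nonemptyChain? ⊤ Bs partition)

  ∑-compositions : ∀ {ℓ} (Bs : Vec (Subset n) ℓ) →
    ∑[ a ← compositions n ℓ ] when (IncrSetCompOfType? α a Bs) 1ℤ ≡ when (orderedPartition? nonemptyChain? ⊤ Bs) 1ℤ
  ∑-compositions {ℓ} Bs with orderedPartition? nonemptyChain? ⊤ Bs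
  ... | yes partition = ∑-unique (compositions n ℓ) (compositions⁺ ℓ) (sizes∈compositions Bs partition)
                                 (λ a → IncrSetCompOfType? α a Bs) (orderedPartition⇒incrSetComp Bs partition)
                                 incrSetComp⇒sizes (λ _ → 1ℤ)
  ... | no ¬partition = ∑-zero (compositions n ℓ) (λ {a} a∈ → when-no (IncrSetCompOfType? α a Bs)
                                 (¬partition ∘ incrSetComp⇒orderedPartition a∈) 1ℤ)

  χ≡χ-on : ∀ t → χ α t ≡ χ-on ⊤ t
  χ≡χ-on t = trans (sumℤ-map (upTo (suc n)) (λ ℓ → sumℤ (List.map (term ℓ) (compositions n ℓ))))
                   (∑-cong (upTo (suc n)) λ ℓ → begin
    sumℤ (List.map (term ℓ) (compositions n ℓ))
      ≡⟨ sumℤ-map (compositions n ℓ) (term ℓ) ⟩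
    ∑[ a ← compositions n ℓ ] (+ c a α * binomℤ t ℓ)
      ≡⟨ ∑-cong (compositions n ℓ) (λ a → ℤP.*-comm (+ c a α) (binomℤ t ℓ)) ⟩
    ∑[ a ← compositions n ℓ ] (binomℤ t ℓ * + c a α)
      ≡⟨ ∑-*ˡ (compositions n ℓ) (binomℤ t ℓ) _ ⟩
    binomℤ t ℓ * ∑[ a ← compositions n ℓ ] (+ c a α)
      ≡⟨ cong (binomℤ t ℓ *_) (count-by-partitions ℓ) ⟩
    binomℤ t ℓ * chainPartitions ℓ ⊤ ∎)
    where
    open ≡-Reasoning
    term : ∀ ℓ → Vec ℕ ℓ → ℤ
    term ℓ a = + c a α * binomℤ t ℓ
    sumℤ-map : ∀ {A : Set} (xs : List A) (f : A → ℤ) → sumℤ (List.map f xs) ≡ ∑ xs f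
    sumℤ-map []       f = refl
    sumℤ-map (x ∷ xs) f = cong (_+_ (f x)) (sumℤ-map xs f)
    count-by-partitions : ∀ ℓ → ∑[ a ← compositions n ℓ ] (+ c a α) ≡ chainPartitions ℓ ⊤
    count-by-partitions ℓ = begin
      ∑[ a ← compositions n ℓ ] (+ c a α)
        ≡⟨ ∑-cong (compositions n ℓ) (λ a → sym (∑-count Bss (IncrSetCompOfType? α a))) ⟩
      ∑[ a ← compositions n ℓ ] ∑[ Bs ← Bss ] when (IncrSetCompOfType? α a Bs) 1ℤ
        ≡⟨ ∑-swap (compositions n ℓ) Bss _ ⟩
      ∑[ Bs ← Bss ] ∑[ a ← compositions n ℓ ] when (IncrSetCompOfType? α a Bs) 1ℤ
        ≡⟨ ∑-cong Bss ∑-compositions ⟩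
      chainPartitions ℓ ⊤ ∎
      where
      Bss : List (Vec (Subset n) ℓ)
      Bss = allVecs (allSubsets n) ℓ

  colourClasses : ∀ {t} → Vec (Fin t) n → Vec (Subset n) t
  colourClasses f = Vec.tabulate (λ k → Vec.tabulate (λ x → does (lookup f x FinP.≟ k)))

  lookup-colourClasses : ∀ {t} (f : Vec (Fin t) n) k x →
                         lookup (lookup (colourClasses f) k) x ≡ does (lookup f x FinP.≟ k)
  lookup-colourClasses f k x = trans (cong (λ B → lookup B x) (Vec.lookup∘tabulate _ k)) (Vec.lookup∘tabulate _ x)

  ∈-colourClasses⁺ : ∀ {t} (f : Vec (Fin t) n) {x k} → lookup f x ≡ k → x ∈ lookup (colourClasses f) k
  ∈-colourClasses⁺ f {x} {k} fx≡k =
    Vec.lookup⇒[]= x _ (trans (lookup-colourClasses f k x) (Dec.dec-true (lookup f x FinP.≟ k) fx≡k))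

  ∈-colourClasses⁻ : ∀ {t} (f : Vec (Fin t) n) {x k} → x ∈ lookup (colourClasses f) k → lookup f x ≡ k
  ∈-colourClasses⁻ f {x} {k} x∈ =
    witness (lookup f x FinP.≟ k) (trans (sym (lookup-colourClasses f k x)) (Vec.[]=⇒lookup x∈))
    where
    witness : (d : Dec (lookup f x ≡ k)) → does d ≡ true → lookup f x ≡ k
    witness (yes fx≡k) _ = fx≡k

  colourClasses-partition : ∀ {t} (f : Vec (Fin t) n) → GoodColoring α f →
                            OrderedPartition (IncreasingOn? α) ⊤ (colourClasses f)
  colourClasses-partition f good = isPartition⇒orderedPartition (IncreasingOn? α) ⊤ (colourClasses f) record
    { disjoint = λ k k′ k≢k′ x x∈k x∈k′ → k≢k′ (trans (sym (∈-colourClasses⁻ f x∈k)) (∈-colourClasses⁻ f x∈k′))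
    ; covering = λ {x} _ → lookup f x , ∈-colourClasses⁺ f refl
    ; within   = λ _ _ → ∈⊤
    ; blocks   = λ k i j i<j αi∈k αj∈k → good i j i<j (trans (∈-colourClasses⁻ f αi∈k) (sym (∈-colourClasses⁻ f αj∈k)))
    }

  colourClasses-injective : ∀ {t} {f g : Vec (Fin t) n} → colourClasses f ≡ colourClasses g → f ≡ g
  colourClasses-injective {f = f} {g} eq = lookup-ext λ x →
    sym (∈-colourClasses⁻ g (subst (λ Bs → x ∈ lookup Bs (lookup f x)) eq (∈-colourClasses⁺ f refl)))

  colourClasses-surjective : ∀ {t} {Bs : Vec (Subset n) t} → OrderedPartition (IncreasingOn? α) ⊤ Bs →
                             ∃ λ f → GoodColoring α f × colourClasses f ≡ Bs
  colourClasses-surjective {t} {Bs} partition = colour , good , lookup-ext (λ k → ⊆-antisym (classes⊆ k) (⊆classes k))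
    where
    open IsPartition (orderedPartition⇒isPartition (IncreasingOn? α) ⊤ Bs partition)
    colour : Vec (Fin t) n
    colour = Vec.tabulate (λ x → proj₁ (covering (∈⊤ {x = x})))
    ∈colour : ∀ x → x ∈ lookup Bs (lookup colour x)
    ∈colour x = subst (λ k → x ∈ lookup Bs k) (sym (Vec.lookup∘tabulate _ x)) (proj₂ (covering ∈⊤))
    colour-unique : ∀ {x k} → x ∈ lookup Bs k → lookup colour x ≡ k
    colour-unique {x} {k} x∈Bₖ with lookup colour x FinP.≟ k
    ... | yes colour≡k = colour≡k
    ... | no  colour≢k = ⊥-elim (disjoint _ _ colour≢k x (∈colour x) x∈Bₖ)
    good : GoodColoring α colour
    good i j i<j same = blocks (lookup colour (α ⟨$⟩ʳ i)) i j i<j (∈colour _)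
      (subst (λ k → α ⟨$⟩ʳ j ∈ lookup Bs k) (sym same) (∈colour _))
    classes⊆ : ∀ k → lookup (colourClasses colour) k ⊆ lookup Bs k
    classes⊆ k {x} x∈ = subst (λ k → x ∈ lookup Bs k) (∈-colourClasses⁻ colour x∈) (∈colour x)
    ⊆classes : ∀ k → lookup Bs k ⊆ lookup (colourClasses colour) k
    ⊆classes k x∈Bₖ = ∈-colourClasses⁺ colour (colour-unique x∈Bₖ)

  numColorings≡ : ∀ t → + numColorings α t ≡ weakChainPartitions t ⊤
  numColorings≡ t = trans
    (cong +_ (count-bijection (GoodColoring? α) (orderedPartition? (IncreasingOn? α) ⊤) (Vec.≡-dec (Vec.≡-dec Bool._≟_))
      (allVecs⁺ (allFin t) (Unique.allFin⁺ t) n) (allVecs⁺ (allSubsets n) (allSubsets⁺ n) t)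
      (λ f → ∈-allVecs (allFin t) f (λ _ → ∈-allFin _)) (λ Bs → ∈-allVecs (allSubsets n) Bs (λ _ → ∈-allSubsets _))
      colourClasses (λ {f} → colourClasses-partition f) (λ _ _ → colourClasses-injective) colourClasses-surjective))
    (sym (∑-count (allVecs (allSubsets n) t) (orderedPartition? (IncreasingOn? α) ⊤)))

theorem4p13 : (n : ℕ) (α : Permutation′ n) →
    ((t : ℕ) → 1 ≤ t → χ α (+ t) ≡ + numColorings α t)
    × (χ α (- (+ 1)) ≡ ((- (+ 1)) ^ n) * (+ d α))
theorem4p13 n α = colourings , at-−1
  where
  open ≡-Reasoning
  colourings : (t : ℕ) → 1 ≤ t → χ α (+ t) ≡ + numColorings α t
  colourings t _ = begin
    χ α (+ t)                  ≡⟨ χ≡χ-on α (+ t) ⟩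
    χ-on α ⊤ (+ t)             ≡⟨ χ-on-ℕ α t ⊤ ⟩
    weakChainPartitions α t ⊤  ≡⟨ numColorings≡ α t ⟨
    + numColorings α t         ∎
  at-−1 : χ α (- 1ℤ) ≡ (- 1ℤ) ^ n * + d α
  at-−1 = begin
    χ α (- 1ℤ)                                ≡⟨ χ≡χ-on α (- 1ℤ) ⟩
    σ α ⊤                                     ≡⟨ σ≡ α (∣⊤∣≡n n) ⟩
    (- 1ℤ) ^ n * noAscentWords α n nothing ⊤  ≡⟨ cong ((- 1ℤ) ^ n *_) (noAscentWords≡d α) ⟩
    (- 1ℤ) ^ n * + d α                        ∎
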